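{- The subspace $\mathrm{Prim}$ of primitive elements of the coalgebra $(\mathcal H,\overset{\circledast}{\Delta})$, i.e. $\{x\in\bigoplus_{n\ge1}\mathbb K[\mathbf{PBT}_n]:\overset{\circledast}{\Delta}(x)=1_{\mathbb K}\otimes x+x\otimes 1_{\mathbb K}\}$, is spanned by the set $\{M_t : t\in\mathbf{PBT}_n,\ n\ge1,\ t \text{ is } \rightthreetimes\text{ -irreducible}\}$.
   Context: A planar binary rooted tree is a planar rooted tree in which every internal vertex has exactly two children; $\mathbf{PBT}_n$ is the set of such trees with $n$ leaves, leaves numbered left to right; $\mathbf{PBT}_1=\{\vert\}$. For trees $t,w$, $t\veebar w$ joins the roots of $t$ (left) and $w$ (right) to a new root; $t\circ_j w$ identifies the root of $w$ with the $j$-th leaf of $t$. Let $\mathcal H=\mathbb K 1_{\mathbb K}\oplus\bigoplus_{n\ge1}\mathbb K[\mathbf{PBT}_n]$, operations extended linearly. Product $\rightthreetimes$: $1_{\mathbb K}$ is a two-sided unit and $t\rightthreetimes w=w\circ_1(t\veebar\vert)$ for trees. A tree $t$ is $\rightthreetimes$-irreducible if there are no trees $u,w$ (elements of $\bigcup_m\mathbf{PBT}_m$) with $t=u\rightthreetimes w$. Coproduct: $\overset{\circledast}{\Delta}(1_{\mathbb K})=1_{\mathbb K}\otimes1_{\mathbb K}$, $\overset{\circledast}{\Delta}(\vert)=1_{\mathbb K}\otimes\vert+\vert\otimes1_{\mathbb K}$, $\overset{\circledast}{\Delta}(t\veebar w)=\sum t_{(1)}\otimes(t_{(2)}\veebar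 w)+\sum(t\veebar w_{(1)})\otimes w_{(2)}-t\otimes w$ (Sweedler notation, conventions $1_{\mathbb K}\veebar w=w$, $t\veebar1_{\mathbb K}=t$). Tamari order $\le_T$ on $\mathbf{PBT}_n$: generated by $(t_1\veebar t_2)\veebar t_3\le_T t_1\veebar(t_2\veebar t_3)$ and compatibility $t_i\le_T w_i\Rightarrow t_1\veebar t_2\le_T w_1\veebar w_2$. $M_t:=\sum_{w\le_T t}\mu(w,t)w$, $\mu$ the Möbius function of $\le_T$. -}

module Defs where

open import Level using (Level; _⊔_) renaming (suc to lsuc)
open import Algebra.Bundles using (CommutativeRing)
open import Data.Nat using (ℕ; zero; suc)
open import Data.List using (List; []; _∷_; map; concat; concatMap; zipWith; reverse; cartesianProductWith; foldr; _++_)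
open import Data.List.Relation.Unary.All using (All)
open import Data.Maybe using (Maybe; nothing; just)
import Data.Maybe.Properties as MaybeP
open import Data.Product using (_×_; _,_; ∃; ∃-syntax; Σ-syntax)
open import Relation.Nullary using (¬_; Dec; yes; no; does)
open import Relation.Binary.Definitions using (Decidable; DecidableEquality)
open import Relation.Binary.PropositionalEquality using (_≡_; _≢_; refl; cong₂)
open import Data.Bool using (if_then_else_)

record Field (c ℓ : Level) : Set (lsuc (c ⊔ ℓ)) where
  field
    commutativeRing : CommutativeRing c ℓ
  open CommutativeRing commutativeRing public
  field
    1≉0     : ¬ (1# ≈ 0#)
    inverse : ∀ x → ¬ (x ≈ 0#) → ∃[ y ] (x * y ≈ 1#)

-- Planar binary rooted trees.  `leaf` is the tree | (one leaf);
-- `t ⋎ w` joins the roots of t (left) and w (right) to a new root.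
-- Every tree has n ≥ 1 leaves, so Tree = ⋃_{n≥1} PBT_n.

infixr 6 _⋎_
data Tree : Set where
  leaf : Tree
  _⋎_  : Tree → Tree → Tree

-- number of internal vertices (= number of leaves − 1)
inner : Tree → ℕ
inner leaf    = 0
inner (t ⋎ w) = suc (inner t Data.Nat.+ inner w)

_≟T_ : DecidableEquality Tree
leaf    ≟T leaf      = yes refl
leaf    ≟T (_ ⋎ _)   = no λ ()
(_ ⋎ _) ≟T leaf      = no λ ()
(t ⋎ w) ≟T (t' ⋎ w') with t ≟T t' | w ≟T w'
... | yes refl | yes refl = yes refl
... | no p     | _        = no λ { refl → p refl }
... | yes _    | no q     = no λ { refl → q refl }

-- Enumeration of trees: table n = [T_n , T_{n-1} , … , T_0], where T_k is
-- the list of all trees with k internal vertices (i.e. PBT_{k+1}).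
table : ℕ → List (List Tree)
table zero    = (leaf ∷ []) ∷ []
table (suc n) =
  concat (zipWith (cartesianProductWith _⋎_) (reverse (table n)) (table n))
  ∷ table n

headL : List (List Tree) → List Tree
headL []       = []
headL (x ∷ _)  = x

-- PBT with (k+1) leaves
PBT : ℕ → List Tree
PBT k = headL (table k)

-- Grafting: t ∘₁ s identifies the root of s with the first (leftmost) leaf of t
_∘₁_ : Tree → Tree → Tree
leaf    ∘₁ s = s
(a ⋎ b) ∘₁ s = (a ∘₁ s) ⋎ b

_⋌_ : Tree → Tree → Tree
t ⋌ w = w ∘₁ (t ⋎ leaf)

⋌-irreducible : Tree → Set
⋌-irreducible t = ¬ (∃[ u ] ∃[ w ] (t ≡ u ⋌ w))

infix 4 _≤T_
data _≤T_ : Tree → Tree → Set where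
  ≤T-refl  : ∀ {t} → t ≤T t
  ≤T-trans : ∀ {t u w} → t ≤T u → u ≤T w → t ≤T w
  ≤T-rot   : ∀ {t₁ t₂ t₃} → (t₁ ⋎ t₂) ⋎ t₃ ≤T t₁ ⋎ (t₂ ⋎ t₃)
  ≤T-cong  : ∀ {t₁ t₂ w₁ w₂} → t₁ ≤T w₁ → t₂ ≤T w₂ → t₁ ⋎ t₂ ≤T w₁ ⋎ w₂

module WithField {c ℓ : Level} (K : Field c ℓ) where
  open Field K

  -- basis of H : nothing = 1_K, just t = the tree t
  Basis : Set
  Basis = Maybe Tree

  _≟B_ : DecidableEquality Basis
  _≟B_ = MaybeP.≡-dec _≟T_

  -- elements of H as finite formal linear combinations
  H : Set c
  H = List (Carrier × Basis)

  -- elements of H ⊗ H as finite formal combinations of basis tensors a ⊗ b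
  H⊗H : Set c
  H⊗H = List (Carrier × Basis × Basis)

  Σ : List Carrier → Carrier
  Σ = foldr _+_ 0#

  coeff : H → Basis → Carrier
  coeff x b = Σ (map (λ { (k , b') → if does (b ≟B b') then k else 0# }) x)

  coeff₂ : H⊗H → Basis → Basis → Carrier
  coeff₂ x a b = Σ (map (λ { (k , a' , b') →
                   if does (a ≟B a') then (if does (b ≟B b') then k else 0#) else 0# }) x)

  _≈H_ : H → H → Set ℓ
  x ≈H y = ∀ b → coeff x b ≈ coeff y b

  _≈H⊗H_ : H⊗H → H⊗H → Set ℓ
  x ≈H⊗H y = ∀ a b → coeff₂ x a b ≈ coeff₂ y a b

  -- x lies in ⊕_{n≥1} K[PBT_n]  (no component on 1_K)
  Positive : H → Set ℓ
  Positive x = coeff x nothing ≈ 0#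

  -- ⋎ with the conventions 1_K ⋎ w = w, t ⋎ 1_K = t (1_K ⋎ 1_K never occurs)
  _⋎B_ : Basis → Basis → Basis
  nothing ⋎B w       = w
  just t  ⋎B nothing = just t
  just t  ⋎B just w  = just (t ⋎ w)

  Δtree : Tree → H⊗H
  Δtree leaf    = (1# , nothing , just leaf) ∷ (1# , just leaf , nothing) ∷ []
  Δtree (t ⋎ w) =
       map (λ { (k , a , b) → (k , a , b ⋎B just w) }) (Δtree t)
    ++ map (λ { (k , a , b) → (k , just t ⋎B a , b) }) (Δtree w)
    ++ ((- 1#) , just t , just w) ∷ []

  ΔB : Basis → H⊗H
  ΔB nothing  = (1# , nothing , nothing) ∷ []
  ΔB (just t) = Δtree t

  Δ : H → H⊗H
  Δ x = concatMap (λ { (k , b) → map (λ { (k' , a₁ , a₂) → (k * k' , a₁ , a₂) }) (ΔB b) }) x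

  1⊗_ : H → H⊗H
  1⊗ x = map (λ { (k , b) → (k , nothing , b) }) x

  _⊗1 : H → H⊗H
  x ⊗1 = map (λ { (k , b) → (k , b , nothing) }) x

  Primitive : H → Set ℓ
  Primitive x = Positive x × (Δ x ≈H⊗H (1⊗ x ++ x ⊗1))

  -- μ is the Möbius function of the Tamari order (computed using a
  -- decision procedure _≤?_ for ≤T; the value of sums does not depend on it):
  --   μ(t,t) = 1  and  Σ_{w ≤ z ≤ t} μ(z,t) = 0  whenever w ≤ t, w ≠ t.
  IsMöbius : Decidable _≤T_ → (Tree → Tree → Carrier) → Set ℓ
  IsMöbius _≤?_ μ =
      (∀ t → μ t t ≈ 1#)
    × (∀ w t → w ≤T t → w ≢ t →
         Σ (concatMap (λ z → if does (w ≤? z) then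
                               (if does (z ≤? t) then μ z t ∷ [] else [])
                             else []) (PBT (inner t))) ≈ 0#)

  M : Decidable _≤T_ → (Tree → Tree → Carrier) → Tree → H
  M _≤?_ μ t = concatMap (λ w → if does (w ≤? t) then (μ w t , just w) ∷ [] else [])
                         (PBT (inner t))

  combM : Decidable _≤T_ → (Tree → Tree → Carrier) → List (Carrier × Tree) → H
  combM _≤?_ μ cs = concatMap (λ { (k , t) → map (λ { (k' , b) → (k * k' , b) }) (M _≤?_ μ t) }) cs

  InSpanIrredM : Decidable _≤T_ → (Tree → Tree → Carrier) → H → Set (c ⊔ ℓ)
  InSpanIrredM _≤?_ μ x =
    ∃[ cs ] (All (λ p → ⋌-irreducible (Data.Product.proj₂ p)) cs × (x ≈H combM _≤?_ μ cs))

-- For x without component on 1 and a tree v, let φ_v(x) = Σ_{z ≥ v} x_z be the up-sum of x along the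
-- Tamari order.  The coproduct of a tree is Δz = 1⊗z + z⊗1 + Σ a⊗b over the splits (a, b) of z, and
-- u ⋌ w ≤ z holds exactly when some split of z dominates (u, w) componentwise; that split is unique,
-- because the left parts of the splits of z have pairwise distinct sizes.  Hence pairing Δx − 1⊗x − x⊗1
-- with φ_u ⊗ φ_w gives φ_{u⋌w}(x), and as the up-sums are unitriangular, x is primitive iff
-- φ_{u⋌w}(x) = 0 for all u, w.  Möbius inversion gives φ_v(M_t) = δ_{vt}, so x = Σ_t φ_t(x) M_t, and the
-- reducible t drop out of this sum exactly when x is primitive.

{-# OPTIONS --safe #-}
module Submission where

open import Defs
open import Level using (Level)
open import Function.Bundles using (_⇔_; mk⇔)
open import Relation.Binary.Definitions using (Decidable)

module Trees where

  open import Function.Base using (_∘_)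
  open import Data.Bool.Base using (Bool; true; false)
  open import Data.Empty using (⊥-elim)
  open import Data.Nat.Base using (ℕ; zero; suc; _+_; _*_; _∸_; _≤_; _<_; z≤n; s≤s)
  open import Data.Nat.Properties
  open import Data.Nat.ListAction using (sum)
  open import Data.Nat.ListAction.Properties using (sum-++)
  open import Data.Nat.Tactic.RingSolver using (solve-∀)
  open import Data.List.Base using (List; []; _∷_; _++_; map; concat; applyUpTo; upTo; zipWith; reverse; cartesianProductWith; _∷ʳ_)
  open import Data.List.Properties using (map-++; map-∘; map-applyUpTo; map-upTo; applyUpTo-∷ʳ; unfold-reverse)
  open import Data.List.Membership.Propositional using (_∈_)
  open import Data.List.Membership.Propositional.Properties using (∈-map⁺; ∈-map⁻; ∈-++⁺ˡ; ∈-++⁺ʳ; ∈-++⁻; ∈-cartesianProductWith⁻)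
  open import Data.List.Relation.Unary.Any using (Any; here; there)
  open import Data.Product.Base using (_×_; _,_; proj₁; ∃₂; map₁; map₂)
  open import Data.Product.Relation.Binary.Pointwise.NonDependent using (×-decidable)
  open import Data.Sum.Base using (_⊎_; inj₁; inj₂)
  open import Relation.Nullary using (¬_; Dec; yes; no; does)
  open import Relation.Nullary.Decidable using (dec-true; dec-false; does-⇔)
  open import Relation.Binary.PropositionalEquality using (_≡_; _≢_; refl; sym; trans; cong; cong₂; subst; module ≡-Reasoning)

  inner-≤T : ∀ {t w} → t ≤T w → inner t ≡ inner w
  inner-≤T ≤T-refl                  = refl
  inner-≤T (≤T-trans p q)           = trans (inner-≤T p) (inner-≤T q)
  inner-≤T {(t₁ ⋎ t₂) ⋎ t₃} ≤T-rot =
    cong suc (trans (cong suc (+-assoc (inner t₁) (inner t₂) (inner t₃))) (sym (+-suc (inner t₁) _)))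
  inner-≤T (≤T-cong p q)            = cong suc (cong₂ _+_ (inner-≤T p) (inner-≤T q))

  -- Every rotation raises the potential, by 1 + inner t₃.
  potential : Tree → ℕ
  potential leaf    = 0
  potential (t ⋎ s) = potential t + potential s + inner s

  ≤T-potential : ∀ {t w} → t ≤T w → t ≡ w ⊎ potential t < potential w
  ≤T-potential ≤T-refl = inj₁ refl
  ≤T-potential (≤T-trans p q) with ≤T-potential p | ≤T-potential q
  ... | inj₁ refl | r         = r
  ... | inj₂ t<u  | inj₁ refl = inj₂ t<u
  ... | inj₂ t<u  | inj₂ u<w  = inj₂ (<-trans t<u u<w)
  ≤T-potential {(t₁ ⋎ t₂) ⋎ t₃} ≤T-rot =
    inj₂ (≤-trans (m≤m+n _ (inner t₃))
                  (≤-reflexive (rotation (potential t₁) (potential t₂) (potential t₃) (inner t₂) (inner t₃))))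
    where
    rotation : ∀ p₁ p₂ p₃ i₂ i₃ → suc (p₁ + p₂ + i₂ + p₃ + i₃) + i₃ ≡ p₁ + (p₂ + p₃ + i₃) + suc (i₂ + i₃)
    rotation = solve-∀
  ≤T-potential (≤T-cong p q) with ≤T-potential p | ≤T-potential q | inner-≤T q
  ... | inj₁ refl | inj₁ refl | _ = inj₁ refl
  ... | inj₁ refl | inj₂ b    | e = inj₂ (+-mono-<-≤ (+-monoʳ-< _ b) (≤-reflexive e))
  ... | inj₂ a    | inj₁ refl | _ = inj₂ (+-monoˡ-< _ (+-monoˡ-< _ a))
  ... | inj₂ a    | inj₂ b    | e = inj₂ (+-mono-<-≤ (+-mono-< a b) (≤-reflexive e))

  ≤T-antisym : ∀ {t w} → t ≤T w → w ≤T t → t ≡ w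
  ≤T-antisym p q with ≤T-potential p | ≤T-potential q
  ... | inj₁ t≡w | _         = t≡w
  ... | inj₂ _   | inj₁ w≡t  = sym w≡t
  ... | inj₂ t<w | inj₂ w<t  = ⊥-elim (<-asym t<w w<t)

  ∘₁-monoˡ-≤T : ∀ {w w'} s → w ≤T w' → w ∘₁ s ≤T w' ∘₁ s
  ∘₁-monoˡ-≤T s ≤T-refl        = ≤T-refl
  ∘₁-monoˡ-≤T s (≤T-trans p q) = ≤T-trans (∘₁-monoˡ-≤T s p) (∘₁-monoˡ-≤T s q)
  ∘₁-monoˡ-≤T s ≤T-rot         = ≤T-rot
  ∘₁-monoˡ-≤T s (≤T-cong p q)  = ≤T-cong (∘₁-monoˡ-≤T s p) q

  ∘₁-monoʳ-≤T : ∀ w {s s'} → s ≤T s' → w ∘₁ s ≤T w ∘₁ s'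
  ∘₁-monoʳ-≤T leaf    p = p
  ∘₁-monoʳ-≤T (a ⋎ b) p = ≤T-cong (∘₁-monoʳ-≤T a p) ≤T-refl

  ⋌-mono-≤T : ∀ {u u' w w'} → u ≤T u' → w ≤T w' → u ⋌ w ≤T u' ⋌ w'
  ⋌-mono-≤T {u' = u'} {w} p q = ≤T-trans (∘₁-monoʳ-≤T w (≤T-cong p ≤T-refl)) (∘₁-monoˡ-≤T (u' ⋎ leaf) q)

  ∘₁-identityʳ : ∀ s → s ∘₁ leaf ≡ s
  ∘₁-identityʳ leaf    = refl
  ∘₁-identityʳ (a ⋎ b) = cong (_⋎ b) (∘₁-identityʳ a)

  ∘₁-⋎-≤T : ∀ w t s → w ∘₁ (t ⋎ s) ≤T t ⋎ (w ∘₁ s)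
  ∘₁-⋎-≤T leaf      t s = ≤T-refl
  ∘₁-⋎-≤T (w₁ ⋎ w₂) t s = ≤T-trans (≤T-cong (∘₁-⋎-≤T w₁ t s) ≤T-refl) ≤T-rot

  ⋌-reducible? : ∀ t → Dec (∃₂ λ u w → t ≡ u ⋌ w)
  ⋌-reducible? leaf = no λ where
    (u , leaf    , ())
    (u , _ ⋎ _   , ())
  ⋌-reducible? (t ⋎ leaf) = yes (t , leaf , refl)
  ⋌-reducible? (t ⋎ (s₁ ⋎ s₂)) with ⋌-reducible? t
  ... | yes (u , w , refl) = yes (u , w ⋎ (s₁ ⋎ s₂) , refl)
  ... | no  irreducible    = no λ where
    (u , leaf    , ())
    (u , w₁ ⋎ w₂ , refl) → irreducible (u , w₁ , refl)

  -- Splits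

  -- Split z a b: a ⊗ b is one of the terms of Δ z other than 1 ⊗ z and z ⊗ 1.
  data Split : Tree → Tree → Tree → Set where
    split-root  : ∀ {t s}     → Split (t ⋎ s) t s
    split-left  : ∀ {t s a b} → Split t a b → Split (t ⋎ s) a (b ⋎ s)
    split-right : ∀ {t s a b} → Split s a b → Split (t ⋎ s) (t ⋎ a) b

  splits : Tree → List (Tree × Tree)
  splits leaf    = []
  splits (t ⋎ s) = map (map₂ (_⋎ s)) (splits t) ++ (t , s) ∷ map (map₁ (t ⋎_)) (splits s)

  Split⇒∈splits : ∀ {z a b} → Split z a b → (a , b) ∈ splits z
  Split⇒∈splits {t ⋎ s} split-root      = ∈-++⁺ʳ (map _ (splits t)) (here refl)
  Split⇒∈splits {t ⋎ s} (split-left p)  = ∈-++⁺ˡ (∈-map⁺ (map₂ (_⋎ s)) (Split⇒∈splits p))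
  Split⇒∈splits {t ⋎ s} (split-right p) = ∈-++⁺ʳ (map _ (splits t)) (there (∈-map⁺ (map₁ (t ⋎_)) (Split⇒∈splits p)))

  ∈splits⇒Split : ∀ {z a b} → (a , b) ∈ splits z → Split z a b
  ∈splits⇒Split {t ⋎ s} m with ∈-++⁻ (map (map₂ (_⋎ s)) (splits t)) m
  ... | inj₁ m' with ∈-map⁻ (map₂ (_⋎ s)) m'
  ...   | _ , m'' , refl = split-left (∈splits⇒Split m'')
  ∈splits⇒Split {t ⋎ s} m | inj₂ (here refl) = split-root
  ∈splits⇒Split {t ⋎ s} m | inj₂ (there m') with ∈-map⁻ (map₁ (t ⋎_)) m'
  ...   | _ , m'' , refl = split-right (∈splits⇒Split m'')

  Split⇒⋌-≤T : ∀ {z a b} → Split z a b → a ⋌ b ≤T z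
  Split⇒⋌-≤T {t ⋎ s} split-root = subst (λ r → s ∘₁ (t ⋎ leaf) ≤T t ⋎ r) (∘₁-identityʳ s) (∘₁-⋎-≤T s t leaf)
  Split⇒⋌-≤T (split-left p)     = ≤T-cong (Split⇒⋌-≤T p) ≤T-refl
  Split⇒⋌-≤T {t ⋎ _} {t ⋎ a} {b} (split-right p) =
    ≤T-trans (∘₁-monoʳ-≤T b (≤T-rot {t} {a} {leaf}))
             (≤T-trans (∘₁-⋎-≤T b t (a ⋎ leaf)) (≤T-cong ≤T-refl (Split⇒⋌-≤T p)))

  Split-⋌ : ∀ u w → Split (u ⋌ w) u w
  Split-⋌ u leaf      = split-root
  Split-⋌ u (w₁ ⋎ w₂) = split-left (Split-⋌ u w₁)

  Split-≤T : ∀ {z z' a b} → z ≤T z' → Split z a b →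
             ∃₂ λ a' b' → Split z' a' b' × a ≤T a' × b ≤T b'
  Split-≤T ≤T-refl p = _ , _ , p , ≤T-refl , ≤T-refl
  Split-≤T (≤T-trans q r) p with Split-≤T q p
  ... | _ , _ , p₁ , a≤a₁ , b≤b₁ with Split-≤T r p₁
  ...   | _ , _ , p₂ , a₁≤a₂ , b₁≤b₂ = _ , _ , p₂ , ≤T-trans a≤a₁ a₁≤a₂ , ≤T-trans b≤b₁ b₁≤b₂
  Split-≤T ≤T-rot split-root                  = _ , _ , split-right split-root , ≤T-refl , ≤T-refl
  Split-≤T ≤T-rot (split-left split-root)     = _ , _ , split-root , ≤T-refl , ≤T-refl
  Split-≤T ≤T-rot (split-left (split-left p)) = _ , _ , split-left p , ≤T-refl , ≤T-rot
  Split-≤T ≤T-rot (split-left (split-right p)) = _ , _ , split-right (split-left p) , ≤T-refl , ≤T-refl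
  Split-≤T ≤T-rot (split-right p)             = _ , _ , split-right (split-right p) , ≤T-rot , ≤T-refl
  Split-≤T (≤T-cong q r) split-root = _ , _ , split-root , q , r
  Split-≤T (≤T-cong q r) (split-left p) with Split-≤T q p
  ... | _ , _ , p' , a≤a' , b≤b' = _ , _ , split-left p' , a≤a' , ≤T-cong b≤b' r
  Split-≤T (≤T-cong q r) (split-right p) with Split-≤T r p
  ... | _ , _ , p' , a≤a' , b≤b' = _ , _ , split-right p' , ≤T-cong q a≤a' , b≤b'

  ⋌-≤T⇒Split : ∀ {u w z} → u ⋌ w ≤T z → ∃₂ λ a b → Split z a b × u ≤T a × w ≤T b
  ⋌-≤T⇒Split {u} {w} q = Split-≤T q (Split-⋌ u w)

  -- Counting

  𝟙ℕ : Bool → ℕ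
  𝟙ℕ true  = 1
  𝟙ℕ false = 0

  𝟙ℕ≤1 : ∀ b → 𝟙ℕ b ≤ 1
  𝟙ℕ≤1 true  = s≤s z≤n
  𝟙ℕ≤1 false = z≤n

  module _ {a p} {A : Set a} {P : A → Set p} where

    count : (∀ x → Dec (P x)) → List A → ℕ
    count P? xs = sum (map (λ x → 𝟙ℕ (does (P? x))) xs)

    count-++ : ∀ (P? : ∀ x → Dec (P x)) xs ys → count P? (xs ++ ys) ≡ count P? xs + count P? ys
    count-++ P? xs ys = trans (cong sum (map-++ _ xs ys)) (sum-++ (map _ xs) _)

    count-concat : ∀ (P? : ∀ x → Dec (P x)) xss → count P? (concat xss) ≡ sum (map (count P?) xss)
    count-concat P? []         = refl
    count-concat P? (xs ∷ xss) = trans (count-++ P? xs (concat xss)) (cong (count P? xs +_) (count-concat P? xss))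

    count-∈ : ∀ (P? : ∀ x → Dec (P x)) {x xs} → x ∈ xs → P x → 1 ≤ count P? xs
    count-∈ P? {xs = y ∷ xs} (here refl) px with P? y
    ... | yes _  = s≤s z≤n
    ... | no ¬py = ⊥-elim (¬py px)
    count-∈ P? {xs = y ∷ xs} (there x∈xs) px with P? y
    ... | yes _ = s≤s z≤n
    ... | no _  = count-∈ P? x∈xs px

    count-none : ∀ (P? : ∀ x → Dec (P x)) xs → (∀ {x} → x ∈ xs → ¬ P x) → count P? xs ≡ 0
    count-none P? []       none = refl
    count-none P? (x ∷ xs) none with P? x
    ... | yes px = ⊥-elim (none (here refl) px)
    ... | no _   = count-none P? xs (none ∘ there)

  module _ {a p q} {A : Set a} {P : A → Set p} {Q : A → Set q} (P? : ∀ x → Dec (P x)) (Q? : ∀ x → Dec (Q x)) where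

    count-cong : (∀ x → P x ⇔ Q x) → ∀ xs → count P? xs ≡ count Q? xs
    count-cong P⇔Q []       = refl
    count-cong P⇔Q (x ∷ xs) = cong₂ (λ b n → 𝟙ℕ b + n) (does-⇔ (P⇔Q x) (P? x) (Q? x)) (count-cong P⇔Q xs)

    count-mono : (∀ {x} → P x → Q x) → ∀ xs → count P? xs ≤ count Q? xs
    count-mono P⇒Q []       = z≤n
    count-mono P⇒Q (x ∷ xs) with P? x | Q? x
    ... | yes _  | yes _  = s≤s (count-mono P⇒Q xs)
    ... | yes px | no ¬qx = ⊥-elim (¬qx (P⇒Q px))
    ... | no _   | yes _  = m≤n⇒m≤1+n (count-mono P⇒Q xs)
    ... | no _   | no _   = count-mono P⇒Q xs

    count-<-mono : (∀ {x} → P x → Q x) → ∀ xs → Any (λ x → ¬ P x × Q x) xs → count P? xs < count Q? xs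
    count-<-mono P⇒Q (x ∷ xs) (here (¬px , qx)) with P? x | Q? x
    ... | yes px | _      = ⊥-elim (¬px px)
    ... | no _   | yes _  = s≤s (count-mono P⇒Q xs)
    ... | no _   | no ¬qx = ⊥-elim (¬qx qx)
    count-<-mono P⇒Q (x ∷ xs) (there any) with P? x | Q? x
    ... | yes _  | yes _  = s≤s (count-<-mono P⇒Q xs any)
    ... | yes px | no ¬qx = ⊥-elim (¬qx (P⇒Q px))
    ... | no _   | yes _  = m≤n⇒m≤1+n (count-<-mono P⇒Q xs any)
    ... | no _   | no _   = count-<-mono P⇒Q xs any

  count-map : ∀ {a b p} {A : Set a} {B : Set b} {P : B → Set p} (P? : ∀ y → Dec (P y)) (f : A → B) xs →
              count P? (map f xs) ≡ count (P? ∘ f) xs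
  count-map P? f xs = cong sum (sym (map-∘ xs))

  sum-applyUpTo-zero : ∀ (h : ℕ → ℕ) m → (∀ i → h i ≡ 0) → sum (applyUpTo h m) ≡ 0
  sum-applyUpTo-zero h zero    h≡0 = refl
  sum-applyUpTo-zero h (suc m) h≡0 = cong₂ _+_ (h≡0 0) (sum-applyUpTo-zero (h ∘ suc) m (h≡0 ∘ suc))

  sum-applyUpTo-single : ∀ (h : ℕ → ℕ) m k → (∀ i → i ≢ k → h i ≡ 0) →
                         sum (applyUpTo h m) ≡ 𝟙ℕ (does (k <? m)) * h k
  sum-applyUpTo-single h zero    k       h≡0 = refl
  sum-applyUpTo-single h (suc m) zero    h≡0 =
    cong (h 0 +_) (sum-applyUpTo-zero (h ∘ suc) m (λ i → h≡0 (suc i) λ ()))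
  sum-applyUpTo-single h (suc m) (suc k) h≡0 =
    cong₂ _+_ (h≡0 0 λ ()) (sum-applyUpTo-single (h ∘ suc) m k (λ i i≢k → h≡0 (suc i) (i≢k ∘ suc-injective)))

  count-upTo≤1 : ∀ n m → count (n ≟_) (upTo m) ≤ 1
  count-upTo≤1 n m = begin
    count (n ≟_) (upTo m)                          ≡⟨ cong sum (map-upTo _ m) ⟩
    sum (applyUpTo (λ i → 𝟙ℕ (does (n ≟ i))) m)    ≡⟨ sum-applyUpTo-single _ m n (λ i i≢n → cong 𝟙ℕ (dec-false (n ≟ i) (i≢n ∘ sym))) ⟩
    𝟙ℕ (does (n <? m)) * 𝟙ℕ (does (n ≟ n))         ≤⟨ *-mono-≤ (𝟙ℕ≤1 (does (n <? m))) (𝟙ℕ≤1 (does (n ≟ n))) ⟩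
    1                                              ∎
    where open ≤-Reasoning

  applyUpTo-suc-+ : ∀ {A : Set} (f : ℕ → A) m n →
                    applyUpTo f (suc (m + n)) ≡ applyUpTo f m ++ f m ∷ applyUpTo (λ k → f (suc (m + k))) n
  applyUpTo-suc-+ f zero    n = refl
  applyUpTo-suc-+ f (suc m) n = cong (f 0 ∷_) (applyUpTo-suc-+ (f ∘ suc) m n)

  splits-left-sizes : ∀ z → map (inner ∘ proj₁) (splits z) ≡ upTo (inner z)
  splits-left-sizes leaf    = refl
  splits-left-sizes (t ⋎ s) = begin
    map (inner ∘ proj₁) (map (map₂ (_⋎ s)) (splits t) ++ (t , s) ∷ map (map₁ (t ⋎_)) (splits s))
      ≡⟨ map-++ (inner ∘ proj₁) (map (map₂ (_⋎ s)) (splits t)) _ ⟩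
    map (inner ∘ proj₁) (map (map₂ (_⋎ s)) (splits t)) ++ inner t ∷ map (inner ∘ proj₁) (map (map₁ (t ⋎_)) (splits s))
      ≡⟨ cong₂ (λ xs ys → xs ++ inner t ∷ ys) (sym (map-∘ (splits t))) (sym (map-∘ (splits s))) ⟩
    map (inner ∘ proj₁) (splits t) ++ inner t ∷ map (λ x → suc (inner t + inner (proj₁ x))) (splits s)
      ≡⟨ cong₂ (λ xs ys → xs ++ inner t ∷ ys) (splits-left-sizes t) (trans (map-∘ (splits s)) (cong (map _) (splits-left-sizes s))) ⟩
    upTo (inner t) ++ inner t ∷ map (λ k → suc (inner t + k)) (upTo (inner s))
      ≡⟨ cong (λ ys → upTo (inner t) ++ inner t ∷ ys) (map-upTo _ (inner s)) ⟩
    upTo (inner t) ++ inner t ∷ applyUpTo (λ k → suc (inner t + k)) (inner s)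
      ≡⟨ sym (applyUpTo-suc-+ (λ k → k) (inner t) (inner s)) ⟩
    upTo (inner (t ⋎ s)) ∎
    where open ≡-Reasoning

  count-splits≤1 : ∀ {p} {P : Tree × Tree → Set p} (P? : ∀ x → Dec (P x)) z n →
                   (∀ {x} → P x → inner (proj₁ x) ≡ n) → count P? (splits z) ≤ 1
  count-splits≤1 P? z n size = begin
    count P? (splits z)                                    ≤⟨ count-mono P? (λ x → n ≟ inner (proj₁ x)) (sym ∘ size) (splits z) ⟩
    count (λ x → n ≟ inner (proj₁ x)) (splits z)           ≡⟨ sym (count-map (n ≟_) (inner ∘ proj₁) (splits z)) ⟩
    count (n ≟_) (map (inner ∘ proj₁) (splits z))          ≡⟨ cong (count (n ≟_)) (splits-left-sizes z) ⟩
    count (n ≟_) (upTo (inner z))                          ≤⟨ count-upTo≤1 n (inner z) ⟩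
    1                                                      ∎
    where open ≤-Reasoning

  count-splits-above : (_≤?_ : Decidable _≤T_) → ∀ u w z →
                       count (×-decidable _≤?_ _≤?_ (u , w)) (splits z) ≡ 𝟙ℕ (does ((u ⋌ w) ≤? z))
  count-splits-above _≤?_ u w z with (u ⋌ w) ≤? z
  ... | yes u⋌w≤z with a , b , split , u≤a , w≤b ← ⋌-≤T⇒Split u⋌w≤z =
    ≤-antisym (count-splits≤1 (×-decidable _≤?_ _≤?_ (u , w)) z (inner u) (λ (u≤a , _) → sym (inner-≤T u≤a)))
              (count-∈ (×-decidable _≤?_ _≤?_ (u , w)) (Split⇒∈splits split) (u≤a , w≤b))
  ... | no u⋌w≰z = count-none (×-decidable _≤?_ _≤?_ (u , w)) (splits z) λ x∈splits (u≤a , w≤b) →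
    u⋌w≰z (≤T-trans (⋌-mono-≤T u≤a w≤b) (Split⇒⋌-≤T (∈splits⇒Split x∈splits)))

  -- Enumeration of planar binary trees

  products : ℕ → ℕ → List Tree
  products n i = cartesianProductWith _⋎_ (PBT i) (PBT (n ∸ i))

  table≡applyUpTo : ∀ n → table n ≡ applyUpTo (λ i → PBT (n ∸ i)) (suc n)
  table≡applyUpTo zero    = refl
  table≡applyUpTo (suc n) = cong (PBT (suc n) ∷_) (table≡applyUpTo n)

  reverse-table : ∀ n → reverse (table n) ≡ applyUpTo PBT (suc n)
  reverse-table zero    = refl
  reverse-table (suc n) = trans (unfold-reverse (PBT (suc n)) (table n))
    (trans (cong (_∷ʳ PBT (suc n)) (reverse-table n)) (applyUpTo-∷ʳ PBT (suc n)))

  zipWith-applyUpTo : ∀ {A B C : Set} (h : A → B → C) f g n →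
                      zipWith h (applyUpTo f n) (applyUpTo g n) ≡ applyUpTo (λ i → h (f i) (g i)) n
  zipWith-applyUpTo h f g zero    = refl
  zipWith-applyUpTo h f g (suc n) = cong (h (f 0) (g 0) ∷_) (zipWith-applyUpTo h (f ∘ suc) (g ∘ suc) n)

  PBT-suc : ∀ n → PBT (suc n) ≡ concat (applyUpTo (products n) (suc n))
  PBT-suc n = cong concat (trans (cong₂ (zipWith (cartesianProductWith _⋎_)) (reverse-table n) (table≡applyUpTo n))
                                 (zipWith-applyUpTo _ PBT (λ i → PBT (n ∸ i)) (suc n)))

  count-PBT-suc : ∀ {p} {P : Tree → Set p} (P? : ∀ x → Dec (P x)) n →
                  count P? (PBT (suc n)) ≡ sum (applyUpTo (count P? ∘ products n) (suc n))
  count-PBT-suc P? n = trans (cong (count P?) (PBT-suc n))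
    (trans (count-concat P? (applyUpTo (products n) (suc n))) (cong sum (map-applyUpTo (products n) (count P?) (suc n))))

  count-products-leaf : ∀ n i → count (leaf ≟T_) (products n i) ≡ 0
  count-products-leaf n i = count-none (leaf ≟T_) (products n i) λ v∈ leaf≡v → nonleaf v∈ leaf≡v
    where
    nonleaf : ∀ {v} → v ∈ products n i → leaf ≢ v
    nonleaf v∈ with _ , _ , _ , _ , refl ← ∈-cartesianProductWith⁻ _⋎_ (PBT i) (PBT (n ∸ i)) v∈ = λ ()

  count-map-⋎ : ∀ a b x B → count ((a ⋎ b) ≟T_) (map (x ⋎_) B) ≡ 𝟙ℕ (does (a ≟T x)) * count (b ≟T_) B
  count-map-⋎ a b x B with a ≟T x
  ... | yes refl = trans (count-map ((x ⋎ b) ≟T_) (x ⋎_) B)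
    (trans (count-cong (λ y → (x ⋎ b) ≟T (x ⋎ y)) (b ≟T_) (λ y → mk⇔ (λ { refl → refl }) (cong (x ⋎_))) B)
           (sym (+-identityʳ _)))
  ... | no a≢x   = trans (count-map ((a ⋎ b) ≟T_) (x ⋎_) B)
    (count-none (λ y → (a ⋎ b) ≟T (x ⋎ y)) B λ _ → λ { refl → a≢x refl })

  count-cartesianProduct-⋎ : ∀ a b A B →
    count ((a ⋎ b) ≟T_) (cartesianProductWith _⋎_ A B) ≡ count (a ≟T_) A * count (b ≟T_) B
  count-cartesianProduct-⋎ a b []      B = refl
  count-cartesianProduct-⋎ a b (x ∷ A) B = begin
    count ((a ⋎ b) ≟T_) (map (x ⋎_) B ++ cartesianProductWith _⋎_ A B)
      ≡⟨ count-++ ((a ⋎ b) ≟T_) (map (x ⋎_) B) _ ⟩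
    count ((a ⋎ b) ≟T_) (map (x ⋎_) B) + count ((a ⋎ b) ≟T_) (cartesianProductWith _⋎_ A B)
      ≡⟨ cong₂ _+_ (count-map-⋎ a b x B) (count-cartesianProduct-⋎ a b A B) ⟩
    𝟙ℕ (does (a ≟T x)) * count (b ≟T_) B + count (a ≟T_) A * count (b ≟T_) B
      ≡⟨ sym (*-distribʳ-+ (count (b ≟T_) B) (𝟙ℕ (does (a ≟T x))) _) ⟩
    count (a ≟T_) (x ∷ A) * count (b ≟T_) B ∎
    where open ≡-Reasoning

  𝟙ℕ-≟-∸ : ∀ a b n → 𝟙ℕ (does (a <? suc n)) * 𝟙ℕ (does (b ≟ n ∸ a)) ≡ 𝟙ℕ (does (a + b ≟ n))
  𝟙ℕ-≟-∸ a b n with a ≤? n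
  ... | yes a≤n rewrite dec-true (a <? suc n) (s≤s a≤n) =
    trans (+-identityʳ _) (cong 𝟙ℕ (does-⇔ (mk⇔ (λ e → trans (cong (a +_) e) (m+[n∸m]≡n a≤n))
                                                 (λ e → trans (sym (m+n∸m≡n a b)) (cong (_∸ a) e)))
                                           (b ≟ n ∸ a) (a + b ≟ n)))
  ... | no a≰n rewrite dec-false (a <? suc n) (a≰n ∘ ≤-pred)
                     | dec-false (a + b ≟ n) (λ e → a≰n (subst (a ≤_) e (m≤m+n a b))) = refl

  count-PBT : ∀ v n → count (v ≟T_) (PBT n) ≡ 𝟙ℕ (does (inner v ≟ n))
  count-PBT leaf    zero    = refl
  count-PBT (_ ⋎ _) zero    = refl
  count-PBT leaf    (suc n) =
    trans (count-PBT-suc (leaf ≟T_) n) (sum-applyUpTo-zero _ (suc n) (count-products-leaf n))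
  count-PBT (a ⋎ b) (suc n) = begin
    count ((a ⋎ b) ≟T_) (PBT (suc n))
      ≡⟨ count-PBT-suc ((a ⋎ b) ≟T_) n ⟩
    sum (applyUpTo (count ((a ⋎ b) ≟T_) ∘ products n) (suc n))
      ≡⟨ sum-applyUpTo-single _ (suc n) (inner a) off-diagonal ⟩
    𝟙ℕ (does (inner a <? suc n)) * count ((a ⋎ b) ≟T_) (products n (inner a))
      ≡⟨ cong (𝟙ℕ (does (inner a <? suc n)) *_) diagonal ⟩
    𝟙ℕ (does (inner a <? suc n)) * 𝟙ℕ (does (inner b ≟ n ∸ inner a))
      ≡⟨ 𝟙ℕ-≟-∸ (inner a) (inner b) n ⟩
    𝟙ℕ (does (inner a + inner b ≟ n)) ∎
    where
    open ≡-Reasoning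
    count-products : ∀ i → count ((a ⋎ b) ≟T_) (products n i) ≡ 𝟙ℕ (does (inner a ≟ i)) * 𝟙ℕ (does (inner b ≟ n ∸ i))
    count-products i = trans (count-cartesianProduct-⋎ a b (PBT i) (PBT (n ∸ i))) (cong₂ _*_ (count-PBT a i) (count-PBT b (n ∸ i)))
    off-diagonal : ∀ i → i ≢ inner a → count ((a ⋎ b) ≟T_) (products n i) ≡ 0
    off-diagonal i i≢a rewrite count-products i | dec-false (inner a ≟ i) (i≢a ∘ sym) = refl
    diagonal : count ((a ⋎ b) ≟T_) (products n (inner a)) ≡ 𝟙ℕ (does (inner b ≟ n ∸ inner a))
    diagonal rewrite count-products (inner a) | dec-true (inner a ≟ inner a) refl = +-identityʳ _

  count-PBT-inner : ∀ v → count (v ≟T_) (PBT (inner v)) ≡ 1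
  count-PBT-inner v = trans (count-PBT v (inner v)) (cong 𝟙ℕ (dec-true (inner v ≟ inner v) refl))

  PBT≤ : ℕ → List Tree
  PBT≤ n = concat (applyUpTo PBT (suc n))

  count-PBT≤ : ∀ v n → count (v ≟T_) (PBT≤ n) ≡ 𝟙ℕ (does (inner v <? suc n))
  count-PBT≤ v n = begin
    count (v ≟T_) (concat (applyUpTo PBT (suc n)))
      ≡⟨ count-concat (v ≟T_) (applyUpTo PBT (suc n)) ⟩
    sum (map (count (v ≟T_)) (applyUpTo PBT (suc n)))
      ≡⟨ cong sum (map-applyUpTo PBT (count (v ≟T_)) (suc n)) ⟩
    sum (applyUpTo (count (v ≟T_) ∘ PBT) (suc n))
      ≡⟨ sum-applyUpTo-single _ (suc n) (inner v) (λ i i≢v → trans (count-PBT v i) (cong 𝟙ℕ (dec-false (inner v ≟ i) (i≢v ∘ sym)))) ⟩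
    𝟙ℕ (does (inner v <? suc n)) * count (v ≟T_) (PBT (inner v))
      ≡⟨ trans (cong (𝟙ℕ (does (inner v <? suc n)) *_) (count-PBT-inner v)) (*-identityʳ _) ⟩
    𝟙ℕ (does (inner v <? suc n)) ∎
    where open ≡-Reasoning


open Trees

module LinearCombinations {c ℓ : Level} (K : Field c ℓ) where

  open Field K renaming (refl to ≈-refl; sym to ≈-sym; trans to ≈-trans)
  open WithField K using (Σ)
  open import Algebra.Properties.AbelianGroup +-abelianGroup using (ε⁻¹≈ε; ⁻¹-∙-comm; x∙y⁻¹≈ε⇒x≈y)
  open import Algebra.Properties.CommutativeSemigroup +-commutativeSemigroup using (interchange; x∙yz≈y∙xz)
  open import Algebra.Properties.Ring ring using (-‿distribʳ-*; -‿distribˡ-*)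
  open import Relation.Binary.Reasoning.Setoid setoid
  open import Data.Bool.Base using (Bool; true; false; _∧_)
  open import Data.Empty using (⊥-elim)
  open import Data.Nat.Base as ℕ using (ℕ; suc; s≤s)
  import Data.Nat.Properties as ℕ
  open import Data.List.Base using (List; []; _∷_; _++_; map; concatMap; filter; length)
  open import Data.List.Properties using (filter-notAll)
  open import Data.List.Membership.Propositional using (_∈_)
  open import Data.List.Relation.Unary.Any as Any using (Any; here; there; any?)
  open import Data.Product.Base using (_×_; _,_; proj₂; map₁)
  open import Function.Base using (_∘_)
  open import Function.Bundles using (Equivalence)
  open import Relation.Nullary using (¬_; Dec; yes; no; does; ¬?)
  open import Relation.Nullary.Decidable using (_×-dec_; dec-false)
  open import Relation.Binary.Definitions using (Decidable; DecidableEquality)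
  open import Relation.Binary.PropositionalEquality as ≡ using (_≡_; _≢_)

  𝟙 : Bool → Carrier
  𝟙 true  = 1#
  𝟙 false = 0#

  𝟙-∧ : ∀ p q → 𝟙 (p ∧ q) ≈ 𝟙 p * 𝟙 q
  𝟙-∧ true  q = ≈-sym (*-identityˡ _)
  𝟙-∧ false q = ≈-sym (zeroˡ _)

  sumOver : ∀ {a} {X : Set a} → List X → (X → Carrier) → Carrier
  sumOver xs f = Σ (map f xs)

  module _ {a} {X : Set a} where

    sumOver-++ : ∀ (xs ys : List X) f → sumOver (xs ++ ys) f ≈ sumOver xs f + sumOver ys f
    sumOver-++ []       ys f = ≈-sym (+-identityˡ _)
    sumOver-++ (x ∷ xs) ys f = ≈-trans (+-cong ≈-refl (sumOver-++ xs ys f)) (≈-sym (+-assoc _ _ _))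

    sumOver-cong : ∀ (xs : List X) {f g} → (∀ x → f x ≈ g x) → sumOver xs f ≈ sumOver xs g
    sumOver-cong []       f≈g = ≈-refl
    sumOver-cong (x ∷ xs) f≈g = +-cong (f≈g x) (sumOver-cong xs f≈g)

    sumOver-cong-∈ : ∀ (xs : List X) {f g} → (∀ {x} → x ∈ xs → f x ≈ g x) → sumOver xs f ≈ sumOver xs g
    sumOver-cong-∈ []       f≈g = ≈-refl
    sumOver-cong-∈ (x ∷ xs) f≈g = +-cong (f≈g (here ≡.refl)) (sumOver-cong-∈ xs (f≈g ∘ there))

    sumOver-zero : ∀ (xs : List X) {f} → (∀ x → f x ≈ 0#) → sumOver xs f ≈ 0#
    sumOver-zero []       f≈0 = ≈-refl
    sumOver-zero (x ∷ xs) f≈0 = ≈-trans (+-cong (f≈0 x) (sumOver-zero xs f≈0)) (+-identityˡ 0#)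

    sumOver-+ : ∀ (xs : List X) f g → sumOver xs (λ x → f x + g x) ≈ sumOver xs f + sumOver xs g
    sumOver-+ []       f g = ≈-sym (+-identityˡ 0#)
    sumOver-+ (x ∷ xs) f g = ≈-trans (+-cong ≈-refl (sumOver-+ xs f g)) (interchange _ _ _ _)

    sumOver-neg : ∀ (xs : List X) f → sumOver xs (λ x → - f x) ≈ - sumOver xs f
    sumOver-neg []       f = ≈-sym ε⁻¹≈ε
    sumOver-neg (x ∷ xs) f = ≈-trans (+-cong ≈-refl (sumOver-neg xs f)) (⁻¹-∙-comm _ _)

    sumOver-*ˡ : ∀ (xs : List X) k f → sumOver xs (λ x → k * f x) ≈ k * sumOver xs f
    sumOver-*ˡ []       k f = ≈-sym (zeroʳ k)
    sumOver-*ˡ (x ∷ xs) k f = ≈-trans (+-cong ≈-refl (sumOver-*ˡ xs k f)) (≈-sym (distribˡ k _ _))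

    sumOver-*ʳ : ∀ (xs : List X) k f → sumOver xs (λ x → f x * k) ≈ sumOver xs f * k
    sumOver-*ʳ []       k f = ≈-sym (zeroˡ k)
    sumOver-*ʳ (x ∷ xs) k f = ≈-trans (+-cong ≈-refl (sumOver-*ʳ xs k f)) (≈-sym (distribʳ k _ _))

    sumOver-𝟙 : ∀ {p} {P : X → Set p} (P? : ∀ x → Dec (P x)) xs {b} →
                count P? xs ≡ 𝟙ℕ b → sumOver xs (λ x → 𝟙 (does (P? x))) ≈ 𝟙 b
    sumOver-𝟙 P? []       {false} _ = ≈-refl
    sumOver-𝟙 P? (x ∷ xs) {true}  n≡1 with P? x
    ... | yes _ = ≈-trans (+-cong ≈-refl (sumOver-𝟙 P? xs {false} (ℕ.suc-injective n≡1))) (+-identityʳ 1#)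
    ... | no _  = ≈-trans (+-identityˡ _) (sumOver-𝟙 P? xs n≡1)
    sumOver-𝟙 P? (x ∷ xs) {false} n≡0 with P? x
    ... | no _  = ≈-trans (+-identityˡ _) (sumOver-𝟙 P? xs n≡0)

    sumOver-δ : ∀ (_≟_ : DecidableEquality X) (xs : List X) v (f : X → Carrier) {b} →
                count (v ≟_) xs ≡ 𝟙ℕ b → sumOver xs (λ x → 𝟙 (does (v ≟ x)) * f x) ≈ 𝟙 b * f v
    sumOver-δ _≟_ xs v f {b} n≡b = begin
      sumOver xs (λ x → 𝟙 (does (v ≟ x)) * f x)  ≈⟨ sumOver-cong xs at-v ⟩
      sumOver xs (λ x → 𝟙 (does (v ≟ x)) * f v)  ≈⟨ sumOver-*ʳ xs (f v) _ ⟩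
      sumOver xs (λ x → 𝟙 (does (v ≟ x))) * f v ≈⟨ *-cong (sumOver-𝟙 (v ≟_) xs n≡b) ≈-refl ⟩
      𝟙 b * f v                                  ∎
      where
      at-v : ∀ x → 𝟙 (does (v ≟ x)) * f x ≈ 𝟙 (does (v ≟ x)) * f v
      at-v x with v ≟ x
      ... | yes ≡.refl = ≈-refl
      ... | no _       = ≈-trans (zeroˡ _) (≈-sym (zeroˡ _))

    sumOver-filter : ∀ {p} {P : X → Set p} (P? : ∀ x → Dec (P x)) xs {f} →
                     (∀ x → ¬ P x → f x ≈ 0#) → sumOver (filter P? xs) f ≈ sumOver xs f
    sumOver-filter P? []       f≈0 = ≈-refl
    sumOver-filter P? (x ∷ xs) f≈0 with P? x
    ... | yes _  = +-cong ≈-refl (sumOver-filter P? xs f≈0)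
    ... | no ¬px = ≈-trans (sumOver-filter P? xs f≈0) (≈-sym (≈-trans (+-cong (f≈0 x ¬px) ≈-refl) (+-identityˡ _)))

  sumOver-map : ∀ {a b} {X : Set a} {Y : Set b} (g : X → Y) xs f → sumOver (map g xs) f ≡ sumOver xs (f ∘ g)
  sumOver-map g []       f = ≡.refl
  sumOver-map g (x ∷ xs) f = ≡.cong (f (g x) +_) (sumOver-map g xs f)

  sumOver-concatMap : ∀ {a b} {X : Set a} {Y : Set b} (g : X → List Y) xs f →
                      sumOver (concatMap g xs) f ≈ sumOver xs (λ x → sumOver (g x) f)
  sumOver-concatMap g []       f = ≈-refl
  sumOver-concatMap g (x ∷ xs) f = ≈-trans (sumOver-++ (g x) (concatMap g xs) f) (+-cong ≈-refl (sumOver-concatMap g xs f))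

  Σ-concatMap : ∀ {a} {X : Set a} (g : X → List Carrier) xs → Σ (concatMap g xs) ≈ sumOver xs (Σ ∘ g)
  Σ-concatMap g []       = ≈-refl
  Σ-concatMap g (x ∷ xs) = ≈-trans (Σ-++ (g x) (concatMap g xs)) (+-cong ≈-refl (Σ-concatMap g xs))
    where
    Σ-++ : ∀ ys zs → Σ (ys ++ zs) ≈ Σ ys + Σ zs
    Σ-++ []       zs = ≈-sym (+-identityˡ _)
    Σ-++ (y ∷ ys) zs = ≈-trans (+-cong ≈-refl (Σ-++ ys zs)) (≈-sym (+-assoc _ _ _))

  ⟨_∣_⟩ : ∀ {B : Set} → (B → Carrier) → List (Carrier × B) → Carrier
  ⟨ g ∣ x ⟩ = sumOver x (λ (k , b) → g b * k)

  negate : ∀ {B : Set} → List (Carrier × B) → List (Carrier × B)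
  negate = map (map₁ (λ k → - k))

  module _ {B : Set} where

    ⟨⟩-cong : ∀ {g h : B → Carrier} x → (∀ b → g b ≈ h b) → ⟨ g ∣ x ⟩ ≈ ⟨ h ∣ x ⟩
    ⟨⟩-cong x g≈h = sumOver-cong x λ (k , b) → *-cong (g≈h b) ≈-refl

    ⟨⟩-+ : ∀ (g h : B → Carrier) x → ⟨ (λ b → g b + h b) ∣ x ⟩ ≈ ⟨ g ∣ x ⟩ + ⟨ h ∣ x ⟩
    ⟨⟩-+ g h x = ≈-trans (sumOver-cong x λ (k , b) → distribʳ k (g b) (h b)) (sumOver-+ x _ _)

    ⟨⟩-neg : ∀ (g : B → Carrier) x → ⟨ (λ b → - g b) ∣ x ⟩ ≈ - ⟨ g ∣ x ⟩
    ⟨⟩-neg g x = ≈-trans (sumOver-cong x λ (k , b) → ≈-sym (-‿distribˡ-* (g b) k)) (sumOver-neg x _)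

    ⟨⟩-++ : ∀ (g : B → Carrier) x y → ⟨ g ∣ x ++ y ⟩ ≈ ⟨ g ∣ x ⟩ + ⟨ g ∣ y ⟩
    ⟨⟩-++ g x y = sumOver-++ x y _

    ⟨⟩-negate : ∀ (g : B → Carrier) x → ⟨ g ∣ negate x ⟩ ≈ - ⟨ g ∣ x ⟩
    ⟨⟩-negate g x = begin
      ⟨ g ∣ negate x ⟩                     ≡⟨ sumOver-map (map₁ (λ k → - k)) x _ ⟩
      sumOver x (λ (k , b) → g b * - k)    ≈⟨ sumOver-cong x (λ (k , b) → ≈-sym (-‿distribʳ-* (g b) k)) ⟩
      sumOver x (λ (k , b) → - (g b * k))  ≈⟨ sumOver-neg x _ ⟩
      - ⟨ g ∣ x ⟩                          ∎

    ⟨⟩-difference : ∀ (g : B → Carrier) x y → ⟨ g ∣ x ++ negate y ⟩ ≈ ⟨ g ∣ x ⟩ + - ⟨ g ∣ y ⟩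
    ⟨⟩-difference g x y = ≈-trans (⟨⟩-++ g x (negate y)) (+-cong ≈-refl (⟨⟩-negate g y))

  module WithDecEq {B : Set} (_≟_ : DecidableEquality B) where

    coefficient : List (Carrier × B) → B → Carrier
    coefficient x b = ⟨ (λ b' → 𝟙 (does (b ≟ b'))) ∣ x ⟩

    infix 4 _≈ᶜ_
    _≈ᶜ_ : List (Carrier × B) → List (Carrier × B) → Set ℓ
    x ≈ᶜ y = ∀ b → coefficient x b ≈ coefficient y b

    𝟙-≢ : ∀ {b b'} → b ≢ b' → 𝟙 (does (b ≟ b')) ≈ 0#
    𝟙-≢ {b} {b'} b≢b' = reflexive (≡.cong 𝟙 (dec-false (b ≟ b') b≢b'))

    without : B → List (Carrier × B) → List (Carrier × B)
    without b = filter (λ (_ , b') → ¬? (b ≟ b'))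

    coefficient-without : ∀ b x → coefficient (without b x) b ≈ 0#
    coefficient-without b []             = ≈-refl
    coefficient-without b ((k , b') ∷ x) with b ≟ b'
    ... | yes _   = coefficient-without b x
    ... | no b≢b' = ≈-trans (+-cong (≈-trans (*-cong (𝟙-≢ b≢b') ≈-refl) (zeroˡ k)) (coefficient-without b x)) (+-identityˡ 0#)

    coefficient-without-≢ : ∀ {b b'} x → b' ≢ b → coefficient (without b x) b' ≈ coefficient x b'
    coefficient-without-≢ {b} {b'} []              b'≢b = ≈-refl
    coefficient-without-≢ {b} {b'} ((k , b₀) ∷ x) b'≢b with b ≟ b₀
    ... | no _      = +-cong ≈-refl (coefficient-without-≢ x b'≢b)
    ... | yes ≡.refl =
      ≈-trans (coefficient-without-≢ x b'≢b)
              (≈-sym (≈-trans (+-cong (≈-trans (*-cong (𝟙-≢ b'≢b) ≈-refl) (zeroˡ k)) ≈-refl) (+-identityˡ _)))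

    ⟨⟩-extract : ∀ (g : B → Carrier) b x → ⟨ g ∣ x ⟩ ≈ g b * coefficient x b + ⟨ g ∣ without b x ⟩
    ⟨⟩-extract g b []              = ≈-sym (≈-trans (+-cong (zeroʳ _) ≈-refl) (+-identityˡ 0#))
    ⟨⟩-extract g b ((k , b') ∷ x) with b ≟ b'
    ... | yes ≡.refl = begin
      g b * k + ⟨ g ∣ x ⟩                                       ≈⟨ +-cong ≈-refl (⟨⟩-extract g b x) ⟩
      g b * k + (g b * coefficient x b + ⟨ g ∣ without b x ⟩)   ≈⟨ ≈-sym (+-assoc _ _ _) ⟩
      g b * k + g b * coefficient x b + ⟨ g ∣ without b x ⟩     ≈⟨ +-cong (≈-sym (distribˡ (g b) k _)) ≈-refl ⟩
      g b * (k + coefficient x b) + ⟨ g ∣ without b x ⟩         ≈⟨ +-cong (*-cong ≈-refl (+-cong (≈-sym (*-identityˡ k)) ≈-refl)) ≈-refl ⟩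
      g b * (1# * k + coefficient x b) + ⟨ g ∣ without b x ⟩    ∎
    ... | no _ = begin
      g b' * k + ⟨ g ∣ x ⟩                                      ≈⟨ +-cong ≈-refl (⟨⟩-extract g b x) ⟩
      g b' * k + (g b * coefficient x b + ⟨ g ∣ without b x ⟩)  ≈⟨ x∙yz≈y∙xz _ _ _ ⟩
      g b * coefficient x b + (g b' * k + ⟨ g ∣ without b x ⟩)  ≈⟨ +-cong (*-cong ≈-refl (≈-sym (≈-trans (+-cong (zeroˡ k) ≈-refl) (+-identityˡ _)))) ≈-refl ⟩
      g b * (0# * k + coefficient x b) + (g b' * k + ⟨ g ∣ without b x ⟩) ∎

    ⟨⟩-vanishing : ∀ (g : B → Carrier) x → (∀ b → g b * coefficient x b ≈ 0#) → ⟨ g ∣ x ⟩ ≈ 0#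
    ⟨⟩-vanishing g x = go x (length x) ℕ.≤-refl
      where
      go : ∀ x n → length x ℕ.≤ n → (∀ b → g b * coefficient x b ≈ 0#) → ⟨ g ∣ x ⟩ ≈ 0#
      go []            _       _         _      = ≈-refl
      go ((k , b) ∷ x) (suc n) (s≤s len) vanish = begin
        ⟨ g ∣ (k , b) ∷ x ⟩
          ≈⟨ ⟨⟩-extract g b ((k , b) ∷ x) ⟩
        g b * coefficient ((k , b) ∷ x) b + ⟨ g ∣ without b ((k , b) ∷ x) ⟩
          ≈⟨ +-cong (vanish b) (go (without b ((k , b) ∷ x)) n shorter vanish-without) ⟩
        0# + 0#
          ≈⟨ +-identityˡ 0# ⟩
        0# ∎
        where
        shorter : length (without b ((k , b) ∷ x)) ℕ.≤ n
        shorter = ℕ.≤-trans (ℕ.≤-pred (filter-notAll (λ (_ , b') → ¬? (b ≟ b')) ((k , b) ∷ x) (here λ b≢b → b≢b ≡.refl))) len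
        vanish-without : ∀ b' → g b' * coefficient (without b ((k , b) ∷ x)) b' ≈ 0#
        vanish-without b' with b' ≟ b
        ... | yes ≡.refl = ≈-trans (*-cong ≈-refl (coefficient-without b ((k , b) ∷ x))) (zeroʳ _)
        ... | no b'≢b    = ≈-trans (*-cong ≈-refl (coefficient-without-≢ ((k , b) ∷ x) b'≢b)) (vanish b')

    coefficient-∉ : ∀ {b} (x : List (Carrier × B)) → ¬ Any ((b ≡_) ∘ proj₂) x → coefficient x b ≈ 0#
    coefficient-∉ {b} [] _ = ≈-refl
    coefficient-∉ {b} ((k , b') ∷ x) b∉x with b ≟ b'
    ... | yes b≡b' = ⊥-elim (b∉x (here b≡b'))
    ... | no _     = ≈-trans (+-cong (zeroˡ k) (coefficient-∉ x (b∉x ∘ there))) (+-identityˡ 0#)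

    ≈ᶜ⇔difference-vanishing : ∀ x y → x ≈ᶜ y ⇔ (∀ b → coefficient (x ++ negate y) b ≈ 0#)
    ≈ᶜ⇔difference-vanishing x y = mk⇔
      (λ x≈y b → ≈-trans (⟨⟩-difference _ x y) (≈-trans (+-cong (x≈y b) ≈-refl) (-‿inverseʳ _)))
      (λ x-y≈0 b → x∙y⁻¹≈ε⇒x≈y _ _ (≈-trans (≈-sym (⟨⟩-difference _ x y)) (x-y≈0 b)))

    ⟨⟩-resp-≈ᶜ : ∀ (g : B → Carrier) x y → x ≈ᶜ y → ⟨ g ∣ x ⟩ ≈ ⟨ g ∣ y ⟩
    ⟨⟩-resp-≈ᶜ g x y x≈y = x∙y⁻¹≈ε⇒x≈y _ _ (begin
      ⟨ g ∣ x ⟩ + - ⟨ g ∣ y ⟩   ≈⟨ ≈-sym (⟨⟩-difference g x y) ⟩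
      ⟨ g ∣ x ++ negate y ⟩     ≈⟨ ⟨⟩-vanishing g (x ++ negate y) (λ b → ≈-trans (*-cong ≈-refl (x-y≈0 b)) (zeroʳ _)) ⟩
      0#                        ∎)
      where
      x-y≈0 = Equivalence.to (≈ᶜ⇔difference-vanishing x y) x≈y

    module Triangular {_≼_ : B → B → Set} (_≼?_ : Decidable _≼_) (≼-refl : ∀ {b} → b ≼ b)
                      (≼-trans : ∀ {a b d} → a ≼ b → b ≼ d → a ≼ d)
                      (≼-antisym : ∀ {a b} → a ≼ b → b ≼ a → a ≡ b) where

      up : B → B → Carrier
      up w b = 𝟙 (does (w ≼? b))

      private
        _≺_ : B → B → Set
        w ≺ b = w ≼ b × w ≢ b

        _≺?_ : Decidable _≺_
        w ≺? b = (w ≼? b) ×-dec ¬? (w ≟ b)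

      up-split : ∀ w b → up w b ≈ 𝟙 (does (w ≟ b)) + 𝟙 (does (w ≺? b))
      up-split w b with w ≟ b
      ... | yes ≡.refl with w ≼? w
      ...   | yes _  = ≈-sym (+-identityʳ 1#)
      ...   | no w⋠w = ⊥-elim (w⋠w ≼-refl)
      up-split w b | no _ with w ≼? b
      ...   | yes _ = ≈-sym (+-identityˡ 1#)
      ...   | no _  = ≈-sym (+-identityˡ 0#)

      count-above-< : ∀ (x : List (Carrier × B)) {w b} → w ≺ b → Any ((b ≡_) ∘ proj₂) x →
                      count (λ e → b ≺? proj₂ e) x ℕ.< count (λ e → w ≺? proj₂ e) x
      count-above-< x {w} {b} (w≼b , w≢b) b∈x =
        count-<-mono (λ e → b ≺? proj₂ e) (λ e → w ≺? proj₂ e) b≺⇒w≺ x (Any.map witness b∈x)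
        where
        b≺⇒w≺ : ∀ {c} → b ≺ c → w ≺ c
        b≺⇒w≺ (b≼c , _) = ≼-trans w≼b b≼c , λ w≡c → w≢b (≼-antisym w≼b (≡.subst (b ≼_) (≡.sym w≡c) b≼c))
        witness : ∀ {c} → b ≡ c → ¬ b ≺ c × w ≺ c
        witness ≡.refl = (λ (_ , b≢b) → b≢b ≡.refl) , (w≼b , w≢b)

      -- Induction on the number of entries of x strictly above w, using [w ≼ b] = δ_wb + [w ≺ b].
      up-vanishing⇒vanishing : ∀ x → (∀ w → ⟨ up w ∣ x ⟩ ≈ 0#) → ∀ w → coefficient x w ≈ 0#
      up-vanishing⇒vanishing x up≈0 w = go (suc (above w)) w ℕ.≤-refl
        where
        above : B → ℕ
        above w = count (λ e → w ≺? proj₂ e) x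
        go : ∀ n v → above v ℕ.< n → coefficient x v ≈ 0#
        go (suc n) v (s≤s above≤n) = begin
          coefficient x v                                        ≈⟨ ≈-sym (+-identityʳ _) ⟩
          coefficient x v + 0#                                   ≈⟨ +-cong ≈-refl (≈-sym strictly-above) ⟩
          coefficient x v + ⟨ (λ b → 𝟙 (does (v ≺? b))) ∣ x ⟩     ≈⟨ ≈-sym (⟨⟩-+ _ _ x) ⟩
          ⟨ (λ b → 𝟙 (does (v ≟ b)) + 𝟙 (does (v ≺? b))) ∣ x ⟩   ≈⟨ ⟨⟩-cong x (λ b → ≈-sym (up-split v b)) ⟩
          ⟨ up v ∣ x ⟩                                           ≈⟨ up≈0 v ⟩
          0#                                                     ∎
          where
          term : ∀ b → 𝟙 (does (v ≺? b)) * coefficient x b ≈ 0#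
          term b with v ≼? b | v ≟ b
          ... | no _    | _     = zeroˡ _
          ... | yes _   | yes _ = zeroˡ _
          ... | yes v≼b | no v≢b with any? (λ e → b ≟ proj₂ e) x
          ...   | yes b∈x = ≈-trans (*-cong ≈-refl (go n b (ℕ.≤-trans (count-above-< x (v≼b , v≢b) b∈x) above≤n))) (zeroʳ _)
          ...   | no b∉x  = ≈-trans (*-cong ≈-refl (coefficient-∉ x b∉x)) (zeroʳ _)
          strictly-above : ⟨ (λ b → 𝟙 (does (v ≺? b))) ∣ x ⟩ ≈ 0#
          strictly-above = ⟨⟩-vanishing _ x term

      ≈ᶜ⇔up : ∀ x y → x ≈ᶜ y ⇔ (∀ w → ⟨ up w ∣ x ⟩ ≈ ⟨ up w ∣ y ⟩)
      ≈ᶜ⇔up x y = mk⇔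
        (λ x≈y w → ⟨⟩-resp-≈ᶜ (up w) x y x≈y)
        (λ up≈ → Equivalence.from (≈ᶜ⇔difference-vanishing x y) (up-vanishing⇒vanishing (x ++ negate y)
           λ w → ≈-trans (⟨⟩-difference (up w) x y) (≈-trans (+-cong (up≈ w) ≈-refl) (-‿inverseʳ _))))

module Primitives {c ℓ : Level} (K : Field c ℓ) (_≤?_ : Decidable _≤T_) where

  open import Data.Maybe.Base using (Maybe; just; nothing)
  open Field K renaming (refl to ≈-refl; sym to ≈-sym; trans to ≈-trans)
  open WithField K
  open LinearCombinations K
  open import Algebra.Properties.AbelianGroup +-abelianGroup using (x∙y⁻¹≈ε⇒x≈y; identityʳ-unique)
  open import Algebra.Properties.Ring ring using (-1*x≈-x)
  open import Algebra.Properties.CommutativeSemigroup *-commutativeSemigroup using (x∙yz≈y∙xz)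
  open import Relation.Binary.Reasoning.Setoid setoid
  open import Tactic.RingSolver.Core.AlmostCommutativeRing using (fromCommutativeRing)
  open import Tactic.RingSolver.NonReflective (fromCommutativeRing commutativeRing (λ _ → nothing)) using (solve; _⊜_; _⊕_)
  open import Data.Bool.Base using (false; if_then_else_)
  open import Data.Empty using (⊥-elim)
  import Data.Nat.Base as ℕ
  import Data.Nat.Properties as ℕ
  open import Data.List.Base using (List; []; _∷_; _++_; map; concatMap; filter)
  open import Data.List.Relation.Unary.All.Properties using (all-filter; map⁺)
  open import Data.List.Membership.Propositional using (_∈_)
  open import Data.List.Relation.Unary.All as All using (All)
  open import Data.Maybe.Relation.Binary.Pointwise as Maybe using (just; nothing)
  open import Data.Product.Base using (_×_; _,_; proj₁; proj₂; map₂)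
  open import Data.Product.Properties using (≡-dec)
  import Data.Product.Relation.Binary.Pointwise.NonDependent as Product
  open import Function.Base using (_∘_)
  open import Function.Bundles using (Equivalence)
  import Function.Properties.Equivalence as ⇔
  open import Relation.Nullary using (¬_; Dec; yes; no; does; ¬?)
  open import Relation.Nullary.Decidable using (dec-false)
  open import Relation.Binary.Definitions using (DecidableEquality)
  open import Relation.Binary.PropositionalEquality as ≡ using (_≡_; _≢_)

  module ℍ = WithDecEq _≟B_

  _≟B²_ : DecidableEquality (Basis × Basis)
  _≟B²_ = ≡-dec _≟B_ _≟B_

  module ℍ⊗ℍ = WithDecEq _≟B²_

  _≼_ : Basis → Basis → Set
  _≼_ = Maybe.Pointwise _≤T_

  ≼-antisym : ∀ {a b} → a ≼ b → b ≼ a → a ≡ b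
  ≼-antisym (just p) (just q) = ≡.cong just (≤T-antisym p q)
  ≼-antisym nothing  nothing  = ≡.refl

  module ℍ↑ = ℍ.Triangular (Maybe.dec _≤?_) (Maybe.refl ≤T-refl) (Maybe.trans ≤T-trans) ≼-antisym

  module ℍ⊗ℍ↑ = ℍ⊗ℍ.Triangular (Product.×-decidable (Maybe.dec _≤?_) (Maybe.dec _≤?_))
    (Maybe.refl ≤T-refl , Maybe.refl ≤T-refl)
    (Product.×-transitive {R = _≼_} {S = _≼_} (Maybe.trans ≤T-trans) (Maybe.trans ≤T-trans))
    (λ (p , q) (p' , q') → ≡.cong₂ _,_ (≼-antisym p p') (≼-antisym q q'))

  φ : Basis → H → Carrier
  φ v x = ⟨ ℍ↑.up v ∣ x ⟩

  coeff≈coefficient : ∀ x b → coeff x b ≈ ℍ.coefficient x b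
  coeff≈coefficient []             b = ≈-refl
  coeff≈coefficient ((k , b') ∷ x) b with b ≟B b'
  ... | yes _ = +-cong (≈-sym (*-identityˡ k)) (coeff≈coefficient x b)
  ... | no _  = +-cong (≈-sym (zeroˡ k)) (coeff≈coefficient x b)

  coeff₂≈coefficient : ∀ X a b → coeff₂ X a b ≈ ℍ⊗ℍ.coefficient X (a , b)
  coeff₂≈coefficient []                  a b = ≈-refl
  coeff₂≈coefficient ((k , a' , b') ∷ X) a b with a ≟B a'
  ... | no _ = +-cong (≈-sym (zeroˡ k)) (coeff₂≈coefficient X a b)
  ... | yes ≡.refl with b ≟B b'
  ...   | yes ≡.refl = +-cong (≈-sym (*-identityˡ k)) (coeff₂≈coefficient X a b)
  ...   | no _       = +-cong (≈-sym (zeroˡ k)) (coeff₂≈coefficient X a b)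

  ≈H⇔≈ᶜ : ∀ x y → x ≈H y ⇔ x ℍ.≈ᶜ y
  ≈H⇔≈ᶜ x y = mk⇔ (λ x≈y b → ≈-trans (≈-sym (coeff≈coefficient x b)) (≈-trans (x≈y b) (coeff≈coefficient y b)))
                  (λ x≈y b → ≈-trans (coeff≈coefficient x b) (≈-trans (x≈y b) (≈-sym (coeff≈coefficient y b))))

  ≈H⊗H⇔≈ᶜ : ∀ X Y → X ≈H⊗H Y ⇔ X ℍ⊗ℍ.≈ᶜ Y
  ≈H⊗H⇔≈ᶜ X Y = mk⇔
    (λ X≈Y (a , b) → ≈-trans (≈-sym (coeff₂≈coefficient X a b)) (≈-trans (X≈Y a b) (coeff₂≈coefficient Y a b)))
    (λ X≈Y a b → ≈-trans (coeff₂≈coefficient X a b) (≈-trans (X≈Y (a , b)) (≈-sym (coeff₂≈coefficient Y a b))))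

  ⟨⟩-agree-on-trees : ∀ x → Positive x → ∀ {g h : Basis → Carrier} →
                      (∀ z → g (just z) ≈ h (just z)) → ⟨ g ∣ x ⟩ ≈ ⟨ h ∣ x ⟩
  ⟨⟩-agree-on-trees x pos {g} {h} g≈h = x∙y⁻¹≈ε⇒x≈y _ _ (begin
    ⟨ g ∣ x ⟩ + - ⟨ h ∣ x ⟩         ≈⟨ +-cong ≈-refl (≈-sym (⟨⟩-neg h x)) ⟩
    ⟨ g ∣ x ⟩ + ⟨ (λ b → - h b) ∣ x ⟩ ≈⟨ ≈-sym (⟨⟩-+ g _ x) ⟩
    ⟨ (λ b → g b + - h b) ∣ x ⟩      ≈⟨ ℍ.⟨⟩-vanishing _ x vanish ⟩
    0#                              ∎)
    where
    vanish : ∀ b → (g b + - h b) * ℍ.coefficient x b ≈ 0#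
    vanish nothing  = ≈-trans (*-cong ≈-refl (≈-trans (≈-sym (coeff≈coefficient x nothing)) pos)) (zeroʳ _)
    vanish (just z) = ≈-trans (*-cong (≈-trans (+-cong (g≈h z) ≈-refl) (-‿inverseʳ _)) ≈-refl) (zeroˡ _)

  ⟨⟩-Δ : ∀ (g : Basis × Basis → Carrier) x → ⟨ g ∣ Δ x ⟩ ≈ ⟨ (λ b → ⟨ g ∣ ΔB b ⟩) ∣ x ⟩
  ⟨⟩-Δ g x = ≈-trans (sumOver-concatMap _ x _) (sumOver-cong x λ (k , b) → begin
    sumOver (map (λ (k' , p) → (k * k' , p)) (ΔB b)) (λ (k' , p) → g p * k')
      ≡⟨ sumOver-map _ (ΔB b) _ ⟩
    sumOver (ΔB b) (λ (k' , p) → g p * (k * k'))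
      ≈⟨ sumOver-cong (ΔB b) (λ (k' , p) → ≈-trans (*-cong ≈-refl (*-comm k k')) (≈-sym (*-assoc (g p) k' k))) ⟩
    sumOver (ΔB b) (λ (k' , p) → g p * k' * k)
      ≈⟨ sumOver-*ʳ (ΔB b) k _ ⟩
    ⟨ g ∣ ΔB b ⟩ * k ∎)

  ⟨⟩-1⊗-++-⊗1 : ∀ (g : Basis × Basis → Carrier) x →
                ⟨ g ∣ 1⊗ x ++ x ⊗1 ⟩ ≈ ⟨ (λ b → g (nothing , b) + g (b , nothing)) ∣ x ⟩
  ⟨⟩-1⊗-++-⊗1 g x = begin
    ⟨ g ∣ 1⊗ x ++ x ⊗1 ⟩                                           ≈⟨ ⟨⟩-++ g (1⊗ x) (x ⊗1) ⟩
    ⟨ g ∣ 1⊗ x ⟩ + ⟨ g ∣ x ⊗1 ⟩                                    ≡⟨ ≡.cong₂ _+_ (sumOver-map _ x _) (sumOver-map _ x _) ⟩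
    ⟨ (λ b → g (nothing , b)) ∣ x ⟩ + ⟨ (λ b → g (b , nothing)) ∣ x ⟩ ≈⟨ ≈-sym (⟨⟩-+ _ _ x) ⟩
    ⟨ (λ b → g (nothing , b) + g (b , nothing)) ∣ x ⟩               ∎

  reducedΔ : (Basis × Basis → Carrier) → Basis → Carrier
  reducedΔ g nothing  = 0#
  reducedΔ g (just z) = sumOver (splits z) (λ (a , b) → g (just a , just b))

  ⟨⟩-Δtree : ∀ (g : Basis × Basis → Carrier) z →
             ⟨ g ∣ Δtree z ⟩ ≈ g (nothing , just z) + g (just z , nothing) + reducedΔ g (just z)
  ⟨⟩-Δtree g leaf = begin
    g (nothing , just leaf) * 1# + (g (just leaf , nothing) * 1# + 0#) ≈⟨ +-cong (*-identityʳ _) (+-identityʳ _) ⟩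
    g (nothing , just leaf) + g (just leaf , nothing) * 1#             ≈⟨ +-cong ≈-refl (*-identityʳ _) ⟩
    g (nothing , just leaf) + g (just leaf , nothing)                   ≈⟨ ≈-sym (+-identityʳ _) ⟩
    g (nothing , just leaf) + g (just leaf , nothing) + 0#              ∎
  ⟨⟩-Δtree g (t ⋎ s) = begin
    ⟨ g ∣ Δtree (t ⋎ s) ⟩
      ≈⟨ ⟨⟩-++ g (map _ (Δtree t)) _ ⟩
    ⟨ g ∣ map _ (Δtree t) ⟩ + ⟨ g ∣ map _ (Δtree s) ++ (- 1# , just t , just s) ∷ [] ⟩
      ≈⟨ +-cong ≈-refl (⟨⟩-++ g (map _ (Δtree s)) _) ⟩
    ⟨ g ∣ map _ (Δtree t) ⟩ + (⟨ g ∣ map _ (Δtree s) ⟩ + (g (just t , just s) * - 1# + 0#))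
      ≡⟨ ≡.cong₂ (λ l r → l + (r + (g (just t , just s) * - 1# + 0#))) (sumOver-map _ (Δtree t) _) (sumOver-map _ (Δtree s) _) ⟩
    ⟨ g₁ ∣ Δtree t ⟩ + (⟨ g₂ ∣ Δtree s ⟩ + (m * - 1# + 0#))
      ≈⟨ +-cong (⟨⟩-Δtree g₁ t) (+-cong (⟨⟩-Δtree g₂ s) (≈-trans (+-identityʳ _) (≈-trans (*-comm _ _) (-1*x≈-x m)))) ⟩
    (A + m + S₁) + ((m + B + S₃) + - m)
      ≈⟨ regroup A B m S₁ S₃ (- m) ⟩
    A + B + (S₁ + (m + S₃)) + (m + - m)
      ≈⟨ ≈-trans (+-cong ≈-refl (-‿inverseʳ m)) (+-identityʳ _) ⟩
    A + B + (S₁ + (m + S₃))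
      ≈⟨ +-cong ≈-refl (≈-sym splits-sum) ⟩
    A + B + reducedΔ g (just (t ⋎ s)) ∎
    where
    g₁ g₂ : Basis × Basis → Carrier
    g₁ (a , b) = g (a , b ⋎B just s)
    g₂ (a , b) = g (just t ⋎B a , b)
    A = g (nothing , just (t ⋎ s))
    B = g (just (t ⋎ s) , nothing)
    m = g (just t , just s)
    S₁ = reducedΔ g₁ (just t)
    S₃ = reducedΔ g₂ (just s)
    regroup : ∀ A B m S₁ S₃ n → (A + m + S₁) + ((m + B + S₃) + n) ≈ A + B + (S₁ + (m + S₃)) + (m + n)
    regroup = solve 6 (λ A B m S₁ S₃ n → ((A ⊕ m ⊕ S₁) ⊕ ((m ⊕ B ⊕ S₃) ⊕ n))
                                       ⊜ (A ⊕ B ⊕ (S₁ ⊕ (m ⊕ S₃)) ⊕ (m ⊕ n))) ≈-refl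
    splits-sum : reducedΔ g (just (t ⋎ s)) ≈ S₁ + (m + S₃)
    splits-sum = ≈-trans (sumOver-++ (map (map₂ (_⋎ s)) (splits t)) _ _)
      (+-cong (reflexive (sumOver-map _ (splits t) _)) (+-cong ≈-refl (reflexive (sumOver-map _ (splits s) _))))

  ⟨⟩-Δ-positive : ∀ (g : Basis × Basis → Carrier) x → Positive x →
                  ⟨ g ∣ Δ x ⟩ ≈ ⟨ g ∣ 1⊗ x ++ x ⊗1 ⟩ + ⟨ reducedΔ g ∣ x ⟩
  ⟨⟩-Δ-positive g x pos = begin
    ⟨ g ∣ Δ x ⟩                                                              ≈⟨ ⟨⟩-Δ g x ⟩
    ⟨ (λ b → ⟨ g ∣ ΔB b ⟩) ∣ x ⟩                                             ≈⟨ ⟨⟩-agree-on-trees x pos (⟨⟩-Δtree g) ⟩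
    ⟨ (λ b → g (nothing , b) + g (b , nothing) + reducedΔ g b) ∣ x ⟩          ≈⟨ ⟨⟩-+ _ (reducedΔ g) x ⟩
    ⟨ (λ b → g (nothing , b) + g (b , nothing)) ∣ x ⟩ + ⟨ reducedΔ g ∣ x ⟩    ≈⟨ +-cong (≈-sym (⟨⟩-1⊗-++-⊗1 g x)) ≈-refl ⟩
    ⟨ g ∣ 1⊗ x ++ x ⊗1 ⟩ + ⟨ reducedΔ g ∣ x ⟩                                 ∎

  reducedΔ-up : ∀ u w b → reducedΔ (ℍ⊗ℍ↑.up (just u , just w)) b ≈ ℍ↑.up (just (u ⋌ w)) b
  reducedΔ-up u w nothing  = ≈-refl
  reducedΔ-up u w (just z) = sumOver-𝟙 (Product.×-decidable _≤?_ _≤?_ (u , w)) (splits z) (count-splits-above _≤?_ u w z)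

  reducedΔ-up-nothingˡ : ∀ β b → reducedΔ (ℍ⊗ℍ↑.up (nothing , β)) b ≈ 0#
  reducedΔ-up-nothingˡ β nothing  = ≈-refl
  reducedΔ-up-nothingˡ β (just z) = sumOver-zero (splits z) λ _ → ≈-refl

  reducedΔ-up-nothingʳ : ∀ α b → reducedΔ (ℍ⊗ℍ↑.up (α , nothing)) b ≈ 0#
  reducedΔ-up-nothingʳ α nothing  = ≈-refl
  reducedΔ-up-nothingʳ α (just z) =
    sumOver-zero (splits z) λ (a , _) → ≈-trans (𝟙-∧ (does (Maybe.dec _≤?_ α (just a))) false) (zeroʳ _)

  primitive⇔φ⋌≈0 : ∀ x → Positive x → Δ x ≈H⊗H (1⊗ x ++ x ⊗1) ⇔ (∀ u w → φ (just (u ⋌ w)) x ≈ 0#)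
  primitive⇔φ⋌≈0 x pos = ⇔.trans (≈H⊗H⇔≈ᶜ (Δ x) P) (⇔.trans (ℍ⊗ℍ↑.≈ᶜ⇔up (Δ x) P) (mk⇔ to from))
    where
    P = 1⊗ x ++ x ⊗1
    Δ≈P⇔reducedΔ≈0 : ∀ p → (⟨ ℍ⊗ℍ↑.up p ∣ Δ x ⟩ ≈ ⟨ ℍ⊗ℍ↑.up p ∣ P ⟩) ⇔ (⟨ reducedΔ (ℍ⊗ℍ↑.up p) ∣ x ⟩ ≈ 0#)
    Δ≈P⇔reducedΔ≈0 p = mk⇔
      (λ Δ≈P → identityʳ-unique _ _ (≈-trans (≈-sym (⟨⟩-Δ-positive (ℍ⊗ℍ↑.up p) x pos)) Δ≈P))
      (λ r≈0 → ≈-trans (⟨⟩-Δ-positive (ℍ⊗ℍ↑.up p) x pos) (≈-trans (+-cong ≈-refl r≈0) (+-identityʳ _)))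
    to : (∀ p → ⟨ ℍ⊗ℍ↑.up p ∣ Δ x ⟩ ≈ ⟨ ℍ⊗ℍ↑.up p ∣ P ⟩) → ∀ u w → φ (just (u ⋌ w)) x ≈ 0#
    to Δ≈P u w = ≈-trans (≈-sym (⟨⟩-cong x (reducedΔ-up u w)))
                         (Equivalence.to (Δ≈P⇔reducedΔ≈0 (just u , just w)) (Δ≈P (just u , just w)))
    from : (∀ u w → φ (just (u ⋌ w)) x ≈ 0#) → ∀ p → ⟨ ℍ⊗ℍ↑.up p ∣ Δ x ⟩ ≈ ⟨ ℍ⊗ℍ↑.up p ∣ P ⟩
    from φ⋌≈0 p = Equivalence.from (Δ≈P⇔reducedΔ≈0 p) (reducedΔ≈0 p)
      where
      reducedΔ≈0 : ∀ p → ⟨ reducedΔ (ℍ⊗ℍ↑.up p) ∣ x ⟩ ≈ 0#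
      reducedΔ≈0 (just u , just w)  = ≈-trans (⟨⟩-cong x (reducedΔ-up u w)) (φ⋌≈0 u w)
      reducedΔ≈0 (nothing , β)      = ≈-trans (⟨⟩-cong x (reducedΔ-up-nothingˡ β)) (sumOver-zero x λ _ → zeroˡ _)
      reducedΔ≈0 (just u , nothing) = ≈-trans (⟨⟩-cong x (reducedΔ-up-nothingʳ (just u))) (sumOver-zero x λ _ → zeroˡ _)

  φ-nothing : ∀ x → φ nothing x ≈ ℍ.coefficient x nothing
  φ-nothing x = ⟨⟩-cong x λ where
    nothing  → ≈-refl
    (just _) → ≈-refl

  maxInner : H → ℕ.ℕ
  maxInner []                  = 0
  maxInner ((_ , nothing) ∷ x) = maxInner x
  maxInner ((_ , just z) ∷ x)  = inner z ℕ.⊔ maxInner x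

  φ-beyond-maxInner : ∀ v x → maxInner x ℕ.< inner v → φ (just v) x ≈ 0#
  φ-beyond-maxInner v []                  _  = ≈-refl
  φ-beyond-maxInner v ((k , nothing) ∷ x) lt = ≈-trans (+-cong (zeroˡ k) (φ-beyond-maxInner v x lt)) (+-identityˡ 0#)
  φ-beyond-maxInner v ((k , just z) ∷ x)  lt with v ≤? z
  ... | yes v≤z = ⊥-elim (ℕ.<-irrefl (≡.sym (inner-≤T v≤z)) (ℕ.≤-<-trans (ℕ.m≤m⊔n (inner z) (maxInner x)) lt))
  ... | no _    =
    ≈-trans (+-cong (zeroˡ k) (φ-beyond-maxInner v x (ℕ.≤-<-trans (ℕ.m≤n⊔m (inner z) (maxInner x)) lt))) (+-identityˡ 0#)

  module _ (μ : Tree → Tree → Carrier) (isMöbius : IsMöbius _≤?_ μ) where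

    interval : Tree → Tree → Tree → List Carrier
    interval v t z = if does (v ≤? z) then (if does (z ≤? t) then μ z t ∷ [] else []) else []

    φ-M≈Σinterval : ∀ v t → φ (just v) (M _≤?_ μ t) ≈ Σ (concatMap (interval v t) (PBT (inner t)))
    φ-M≈Σinterval v t = begin
      φ (just v) (M _≤?_ μ t)
        ≈⟨ sumOver-concatMap _ (PBT (inner t)) _ ⟩
      sumOver (PBT (inner t)) (λ z → φ (just v) (if does (z ≤? t) then (μ z t , just z) ∷ [] else []))
        ≈⟨ sumOver-cong (PBT (inner t)) term ⟩
      sumOver (PBT (inner t)) (Σ ∘ interval v t)
        ≈⟨ ≈-sym (Σ-concatMap (interval v t) (PBT (inner t))) ⟩
      Σ (concatMap (interval v t) (PBT (inner t))) ∎
      where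
      term : ∀ z → φ (just v) (if does (z ≤? t) then (μ z t , just z) ∷ [] else []) ≈ Σ (interval v t z)
      term z with z ≤? t
      ... | yes _ with v ≤? z
      ...   | yes _ = +-cong (*-identityˡ _) ≈-refl
      ...   | no _  = ≈-trans (+-identityʳ _) (zeroˡ _)
      term z | no _ with v ≤? z
      ...   | yes _ = ≈-refl
      ...   | no _  = ≈-refl

    φ-M : ∀ v t → φ (just v) (M _≤?_ μ t) ≈ 𝟙 (does (v ≟T t))
    φ-M v t with v ≟T t
    ... | yes ≡.refl = begin
      φ (just t) (M _≤?_ μ t)                                     ≈⟨ φ-M≈Σinterval t t ⟩
      Σ (concatMap (interval t t) (PBT (inner t)))                ≈⟨ Σ-concatMap (interval t t) (PBT (inner t)) ⟩
      sumOver (PBT (inner t)) (Σ ∘ interval t t)                  ≈⟨ sumOver-cong (PBT (inner t)) diagonal ⟩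
      sumOver (PBT (inner t)) (λ z → 𝟙 (does (t ≟T z)) * μ z t)  ≈⟨ sumOver-δ _≟T_ (PBT (inner t)) t (λ z → μ z t) (count-PBT-inner t) ⟩
      1# * μ t t                                                  ≈⟨ *-identityˡ _ ⟩
      μ t t                                                       ≈⟨ proj₁ isMöbius t ⟩
      1#                                                          ∎
      where
      diagonal : ∀ z → Σ (interval t t z) ≈ 𝟙 (does (t ≟T z)) * μ z t
      diagonal z with t ≟T z
      ... | yes ≡.refl with t ≤? t
      ...   | yes _   = ≈-trans (+-identityʳ _) (≈-sym (*-identityˡ _))
      ...   | no t≰t  = ⊥-elim (t≰t ≤T-refl)
      diagonal z | no t≢z with t ≤? z | z ≤? t
      ...   | yes t≤z | yes z≤t = ⊥-elim (t≢z (≤T-antisym t≤z z≤t))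
      ...   | yes _   | no _    = ≈-sym (zeroˡ _)
      ...   | no _    | _       = ≈-sym (zeroˡ _)
    ... | no v≢t with v ≤? t
    ...   | yes v≤t = ≈-trans (φ-M≈Σinterval v t) (proj₂ isMöbius v t v≤t v≢t)
    ...   | no v≰t  = begin
      φ (just v) (M _≤?_ μ t)                       ≈⟨ φ-M≈Σinterval v t ⟩
      Σ (concatMap (interval v t) (PBT (inner t)))  ≈⟨ Σ-concatMap (interval v t) (PBT (inner t)) ⟩
      sumOver (PBT (inner t)) (Σ ∘ interval v t)    ≈⟨ sumOver-zero (PBT (inner t)) empty ⟩
      0#                                            ∎
      where
      empty : ∀ z → Σ (interval v t z) ≈ 0#
      empty z with v ≤? z | z ≤? t
      ... | yes v≤z | yes z≤t = ⊥-elim (v≰t (≤T-trans v≤z z≤t))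
      ... | yes _   | no _    = ≈-refl
      ... | no _    | _       = ≈-refl

    ⟨⟩-combM : ∀ (g : Basis → Carrier) cs → ⟨ g ∣ combM _≤?_ μ cs ⟩ ≈ sumOver cs (λ (k , t) → k * ⟨ g ∣ M _≤?_ μ t ⟩)
    ⟨⟩-combM g cs = ≈-trans (sumOver-concatMap _ cs _) (sumOver-cong cs λ (k , t) → begin
      sumOver (map (λ (k' , b) → (k * k' , b)) (M _≤?_ μ t)) (λ (k' , b) → g b * k')
        ≡⟨ sumOver-map _ (M _≤?_ μ t) _ ⟩
      sumOver (M _≤?_ μ t) (λ (k' , b) → g b * (k * k'))
        ≈⟨ sumOver-cong (M _≤?_ μ t) (λ (k' , b) → x∙yz≈y∙xz (g b) k k') ⟩
      sumOver (M _≤?_ μ t) (λ (k' , b) → k * (g b * k'))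
        ≈⟨ sumOver-*ˡ (M _≤?_ μ t) k _ ⟩
      k * ⟨ g ∣ M _≤?_ μ t ⟩ ∎)

    M-positive : ∀ t → ℍ.coefficient (M _≤?_ μ t) nothing ≈ 0#
    M-positive t = ≈-trans (sumOver-concatMap _ (PBT (inner t)) _) (sumOver-zero (PBT (inner t)) term)
      where
      term : ∀ z → ℍ.coefficient (if does (z ≤? t) then (μ z t , just z) ∷ [] else []) nothing ≈ 0#
      term z with z ≤? t
      ... | yes _ = ≈-trans (+-identityʳ _) (zeroˡ _)
      ... | no _  = ≈-refl

    combM-positive : ∀ cs → ℍ.coefficient (combM _≤?_ μ cs) nothing ≈ 0#
    combM-positive cs = ≈-trans (⟨⟩-combM (λ b → 𝟙 (does (nothing ≟B b))) cs)
                                (sumOver-zero cs λ (k , t) → ≈-trans (*-cong ≈-refl (M-positive t)) (zeroʳ k))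

    ≈H-from-φ : ∀ x y → Positive x → ℍ.coefficient y nothing ≈ 0# → (∀ v → φ (just v) x ≈ φ (just v) y) → x ≈H y
    ≈H-from-φ x y x-positive y-positive φx≈φy = Equivalence.from (≈H⇔≈ᶜ x y) (Equivalence.from (ℍ↑.≈ᶜ⇔up x y) λ where
      nothing  → begin
        φ nothing x              ≈⟨ φ-nothing x ⟩
        ℍ.coefficient x nothing  ≈⟨ ≈-trans (≈-sym (coeff≈coefficient x nothing)) x-positive ⟩
        0#                       ≈⟨ ≈-sym y-positive ⟩
        ℍ.coefficient y nothing  ≈⟨ ≈-sym (φ-nothing y) ⟩
        φ nothing y              ∎
      (just v) → φx≈φy v)

    φ⋌-combM-irreducible : ∀ cs → All (⋌-irreducible ∘ proj₂) cs → ∀ u w → φ (just (u ⋌ w)) (combM _≤?_ μ cs) ≈ 0#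
    φ⋌-combM-irreducible cs irreducible u w = begin
      φ (just (u ⋌ w)) (combM _≤?_ μ cs)                           ≈⟨ ⟨⟩-combM (ℍ↑.up (just (u ⋌ w))) cs ⟩
      sumOver cs (λ (k , t) → k * φ (just (u ⋌ w)) (M _≤?_ μ t))  ≈⟨ sumOver-cong-∈ cs term ⟩
      sumOver cs (λ _ → 0#)                                        ≈⟨ sumOver-zero cs (λ _ → ≈-refl) ⟩
      0#                                                           ∎
      where
      term : ∀ {e} → e ∈ cs → proj₁ e * φ (just (u ⋌ w)) (M _≤?_ μ (proj₂ e)) ≈ 0#
      term {k , t} e∈cs = ≈-trans (*-cong ≈-refl (≈-trans (φ-M (u ⋌ w) t) (reflexive (≡.cong 𝟙 (dec-false ((u ⋌ w) ≟T t) u⋌w≢t)))))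
                                  (zeroʳ k)
        where
        u⋌w≢t : u ⋌ w ≢ t
        u⋌w≢t u⋌w≡t = All.lookup irreducible e∈cs (u , w , ≡.sym u⋌w≡t)

    inSpan⇒primitive : ∀ x → InSpanIrredM _≤?_ μ x → Primitive x
    inSpan⇒primitive x (cs , irreducible , x≈cs) =
      positive , Equivalence.from (primitive⇔φ⋌≈0 x positive) λ u w →
        ≈-trans (ℍ.⟨⟩-resp-≈ᶜ (ℍ↑.up (just (u ⋌ w))) x (combM _≤?_ μ cs) x≈ᶜcs) (φ⋌-combM-irreducible cs irreducible u w)
      where
      x≈ᶜcs : x ℍ.≈ᶜ combM _≤?_ μ cs
      x≈ᶜcs = Equivalence.to (≈H⇔≈ᶜ x (combM _≤?_ μ cs)) x≈cs
      positive : Positive x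
      positive = ≈-trans (coeff≈coefficient x nothing) (≈-trans (x≈ᶜcs nothing) (combM-positive cs))

    irreducibleTerms : H → List (Carrier × Tree)
    irreducibleTerms x = map (λ t → (φ (just t) x , t)) (filter (¬? ∘ ⋌-reducible?) (PBT≤ (maxInner x)))

    φ-irreducibleTerms : ∀ x → (∀ u w → φ (just (u ⋌ w)) x ≈ 0#) →
                         ∀ v → φ (just v) (combM _≤?_ μ (irreducibleTerms x)) ≈ φ (just v) x
    φ-irreducibleTerms x φ⋌≈0 v = begin
      φ (just v) (combM _≤?_ μ (irreducibleTerms x))
        ≈⟨ ⟨⟩-combM (ℍ↑.up (just v)) (irreducibleTerms x) ⟩
      sumOver (irreducibleTerms x) (λ (k , t) → k * φ (just v) (M _≤?_ μ t))
        ≡⟨ sumOver-map _ (filter (¬? ∘ ⋌-reducible?) (PBT≤ N)) _ ⟩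
      sumOver (filter (¬? ∘ ⋌-reducible?) (PBT≤ N)) (λ t → φ (just t) x * φ (just v) (M _≤?_ μ t))
        ≈⟨ sumOver-filter (¬? ∘ ⋌-reducible?) (PBT≤ N) reducible-term ⟩
      sumOver (PBT≤ N) (λ t → φ (just t) x * φ (just v) (M _≤?_ μ t))
        ≈⟨ sumOver-cong (PBT≤ N) (λ t → ≈-trans (*-cong ≈-refl (φ-M v t)) (*-comm _ _)) ⟩
      sumOver (PBT≤ N) (λ t → 𝟙 (does (v ≟T t)) * φ (just t) x)
        ≈⟨ sumOver-δ _≟T_ (PBT≤ N) v (λ t → φ (just t) x) (count-PBT≤ v N) ⟩
      𝟙 (does (inner v ℕ.<? ℕ.suc N)) * φ (just v) x
        ≈⟨ in-range (inner v ℕ.<? ℕ.suc N) ⟩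
      φ (just v) x ∎
      where
      N = maxInner x
      reducible-term : ∀ t → ¬ ⋌-irreducible t → φ (just t) x * φ (just v) (M _≤?_ μ t) ≈ 0#
      reducible-term t reducible with ⋌-reducible? t
      ... | yes (u , w , ≡.refl) = ≈-trans (*-cong (φ⋌≈0 u w) ≈-refl) (zeroˡ _)
      ... | no irreducible       = ⊥-elim (reducible irreducible)
      in-range : (v≤N? : Dec (inner v ℕ.< ℕ.suc N)) → 𝟙 (does v≤N?) * φ (just v) x ≈ φ (just v) x
      in-range (yes _)    = *-identityˡ _
      in-range (no v≮1+N) = ≈-trans (zeroˡ _) (≈-sym (φ-beyond-maxInner v x (ℕ.≮⇒≥ v≮1+N)))

    primitive⇒inSpan : ∀ x → Primitive x → InSpanIrredM _≤?_ μ x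
    primitive⇒inSpan x (positive , Δx≈) =
        irreducibleTerms x
      , map⁺ (all-filter (¬? ∘ ⋌-reducible?) (PBT≤ (maxInner x)))
      , ≈H-from-φ x (combM _≤?_ μ (irreducibleTerms x)) positive (combM-positive (irreducibleTerms x))
          (λ v → ≈-sym (φ-irreducibleTerms x (Equivalence.to (primitive⇔φ⋌≈0 x positive) Δx≈) v))

corollary3p3 : ∀ {c ℓ : Level} (K : Field c ℓ) → let open WithField K in
    (_≤?_ : Decidable _≤T_) (μ : Tree → Tree → Field.Carrier K) →
    IsMöbius _≤?_ μ →
    ∀ (x : H) → Primitive x ⇔ InSpanIrredM _≤?_ μ x
corollary3p3 K _≤?_ μ isMöbius x = mk⇔ (primitive⇒inSpan μ isMöbius x) (inSpan⇒primitive μ isMöbius x)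
  where open Primitives K _≤?_
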